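{- Let $d \geq 2$ be a fixed integer. There is a constant $c = c(d) > 0$ such that for every positive integer $n$ there is a subset $A \subset [n]^d$ with $|A| \geq c n$ such that no $d+1$ points of $A$ lie on a common hyperplane in $\mathbb{R}^d$ and no $2d$ points of $A$ lie on a common sphere in $\mathbb{R}^d$.
   Context: $[n] = \{1,\ldots,n\}$. A sphere is a $(d-1)$-dimensional sphere in $\mathbb{R}^d$. The paper writes the size as $\Omega(n)$.
   Formalization: The hyperplanes and spheres in $\mathbb{R}^d$ are replaced by ones with rational normal vectors and offsets, and rational centres and squared radii, rather than real ones. -}

module Defs where

open import Data.Nat as ℕ using (ℕ; zero; suc)
open import Data.Integer using (+_)
open import Data.Fin as F using (Fin)
open import Data.Product using (Σ; ∃; _×_)
open import Data.Rational using (ℚ; 0ℚ; _+_; _*_; _-_; _/_; _<_)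
open import Relation.Binary.PropositionalEquality using (_≡_; _≢_)
open import Relation.Nullary using (¬_)

-- A point of the integer grid ℤ^d (coordinates are natural numbers here,
-- membership in [n]^d is imposed separately by InGrid).
Point : ℕ → Set
Point d = Fin d → ℕ

InGrid : (n : ℕ) {d : ℕ} → Point d → Set
InGrid n {d} p = ∀ j → 1 ℕ.≤ p j × p j ℕ.≤ n

toℚ : ℕ → ℚ
toℚ k = + k / 1

sumℚ : (d : ℕ) → (Fin d → ℚ) → ℚ
sumℚ zero    f = 0ℚ
sumℚ (suc d) f = f F.zero + sumℚ d (λ j → f (F.suc j))

OnHyperplane : {d : ℕ} → (a : Fin d → ℚ) → (b : ℚ) → Point d → Set
OnHyperplane {d} a b p = sumℚ d (λ j → a j * toℚ (p j)) ≡ b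

NonZeroVec : {d : ℕ} → (Fin d → ℚ) → Set
NonZeroVec a = ∃ λ j → a j ≢ 0ℚ

OnSphere : {d : ℕ} → (c : Fin d → ℚ) → (ρ : ℚ) → Point d → Set
OnSphere {d} c ρ p = sumℚ d (λ j → (toℚ (p j) - c j) * (toℚ (p j) - c j)) ≡ ρ

OnCommonHyperplane : {d k : ℕ} → (Fin k → Point d) → Set
OnCommonHyperplane {d} P =
  Σ (Fin d → ℚ) λ a → Σ ℚ λ b → NonZeroVec a × (∀ i → OnHyperplane a b (P i))

OnCommonSphere : {d k : ℕ} → (Fin k → Point d) → Set
OnCommonSphere {d} P =
  Σ (Fin d → ℚ) λ c → Σ ℚ λ ρ → (0ℚ < ρ) × (∀ i → OnSphere c ρ (P i))

module Submission where

-- Take a prime p and the points x(t) = (t mod p, t² mod p, …, t^d mod p) for 1 ≤ t ≤ T, where 2dT < p;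
-- they lie in [p]^d. A hyperplane through d + 1 of them, after clearing denominators and dividing out
-- powers of p (descent), is a polynomial relation of degree ≤ d that is not identically zero modulo p
-- but has d + 1 distinct roots t. A sphere through 2d of them gives, in the same way, a polynomial
-- relation Σⱼ t^2j + (terms of degree ≤ d) of degree 2d with 2d distinct roots tᵢ; as d ≥ 2 its
-- coefficient of t^(2d-1) vanishes, so by Vieta p divides Σ tᵢ, which lies in (0, p). A weak form of
-- Bertrand's theorem — a prime in (2^(2i+5), 2^(2i+10)], from Erdős's bounds on (2m choose m) — provides
-- such a p with n/128 < p ≤ n, and then T ≥ n / (1 + 1024 d).

open import Data.Nat.Primality using (Prime)

module Binomial where

  open import Data.Nat.Base
  open import Data.Nat.Properties
  open import Relation.Binary.PropositionalEquality
  open import Data.Nat.Tactic.RingSolver using (solve-∀)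

  -- binomial a b is the binomial coefficient (a + b choose a)
  binomial : ℕ → ℕ → ℕ
  binomial zero    b       = 1
  binomial (suc a) zero    = 1
  binomial (suc a) (suc b) = binomial a (suc b) + binomial (suc a) b

  binomial-*-!*! : ∀ a b → binomial a b * (a ! * b !) ≡ (a + b) !
  binomial-*-!*! zero    b    = trans (+-identityʳ _) (*-identityˡ _)
  binomial-*-!*! (suc a) zero rewrite +-identityʳ a = trans (+-identityʳ _) (*-identityʳ _)
  binomial-*-!*! (suc a) (suc b) = begin
    (X + Y) * (suc a ! * suc b !)                                   ≡⟨ split X Y a b (a !) (b !) ⟩
    suc a * (X * (a ! * suc b !)) + suc b * (Y * (suc a ! * b !))    ≡⟨ cong₂ (λ u v → suc a * u + suc b * v) IH₁ IH₂ ⟩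
    suc a * (suc (a + b)) ! + suc b * (suc (a + b)) !                ≡⟨ collect a b ((suc (a + b)) !) ⟩
    suc (suc (a + b)) !                                              ≡⟨ cong (λ n → suc n !) (+-suc a b) ⟨
    (suc a + suc b) !                                                ∎
    where
    open ≡-Reasoning
    X = binomial a (suc b)
    Y = binomial (suc a) b
    IH₁ : X * (a ! * suc b !) ≡ (suc (a + b)) !
    IH₁ = trans (binomial-*-!*! a (suc b)) (cong _! (+-suc a b))
    IH₂ : Y * (suc a ! * b !) ≡ (suc (a + b)) !
    IH₂ = binomial-*-!*! (suc a) b
    split : ∀ X Y a b f g → (X + Y) * ((suc a * f) * (suc b * g)) ≡
            suc a * (X * (f * (suc b * g))) + suc b * (Y * ((suc a * f) * g))
    split = solve-∀
    collect : ∀ a b w → suc a * w + suc b * w ≡ suc (suc (a + b)) * w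
    collect = solve-∀

  binomial>0 : ∀ a b → 0 < binomial a b
  binomial>0 zero    b       = z<s
  binomial>0 (suc a) zero    = z<s
  binomial>0 (suc a) (suc b) = ≤-trans (binomial>0 a (suc b)) (m≤m+n _ _)

  binomial-monoʳ-≤ : ∀ a b → binomial a b ≤ binomial a (suc b)
  binomial-monoʳ-≤ zero    b       = ≤-refl
  binomial-monoʳ-≤ (suc a) zero    = m≤n+m 1 _
  binomial-monoʳ-≤ (suc a) (suc b) = +-mono-≤ (binomial-monoʳ-≤ a (suc b)) (binomial-monoʳ-≤ (suc a) b)

  binomial-monoˡ-≤ : ∀ a b → binomial a b ≤ binomial (suc a) b
  binomial-monoˡ-≤ zero    zero    = ≤-refl
  binomial-monoˡ-≤ zero    (suc b) = m≤m+n 1 _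
  binomial-monoˡ-≤ (suc a) zero    = ≤-refl
  binomial-monoˡ-≤ (suc a) (suc b) = +-mono-≤ (binomial-monoˡ-≤ a (suc b)) (binomial-monoˡ-≤ (suc a) b)

  2^m≤binomial[m,m] : ∀ m → 2 ^ m ≤ binomial m m
  2^m≤binomial[m,m] zero    = ≤-refl
  2^m≤binomial[m,m] (suc m) = begin
    2 ^ suc m                             ≡⟨ cong (2 ^ m +_) (+-identityʳ (2 ^ m)) ⟩
    2 ^ m + 2 ^ m                         ≤⟨ +-mono-≤ (≤-trans IH (binomial-monoʳ-≤ m m)) (≤-trans IH (binomial-monoˡ-≤ m m)) ⟩
    binomial m (suc m) + binomial (suc m) m ∎
    where
    open ≤-Reasoning
    IH = 2^m≤binomial[m,m] m

  binomial≤2^[a+b] : ∀ a b → binomial a b ≤ 2 ^ (a + b)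
  binomial≤2^[a+b] zero    b       = m^n>0 2 b
  binomial≤2^[a+b] (suc a) zero    = m^n>0 2 (suc a + zero)
  binomial≤2^[a+b] (suc a) (suc b) = begin
    binomial a (suc b) + binomial (suc a) b ≤⟨ +-mono-≤ (binomial≤2^[a+b] a (suc b)) (binomial≤2^[a+b] (suc a) b) ⟩
    2 ^ (a + suc b) + 2 ^ suc (a + b)       ≡⟨ cong (λ n → 2 ^ n + 2 ^ suc (a + b)) (+-suc a b) ⟩
    2 ^ suc (a + b) + 2 ^ suc (a + b)       ≡⟨ cong (2 ^ suc (a + b) +_) (+-identityʳ _) ⟨
    2 ^ suc (suc (a + b))                   ≡⟨ cong (λ n → 2 ^ suc n) (+-suc a b) ⟨
    2 ^ (suc a + suc b)                     ∎
    where open ≤-Reasoning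

module Primes where

  open import Data.Nat.Base
  open import Data.Nat.Properties
  open import Data.Nat.Divisibility
  open import Data.Nat.Primality
  open import Data.Nat.Primality.Factorisation using (factorise)
  open import Data.Nat.Coprimality using (Coprime)
  open import Data.Nat.ListAction using (product)
  open import Data.List.Base using ([]; _∷_)
  open import Data.List.Relation.Unary.All using (_∷_)
  open import Data.Product.Base using (∃; _×_; _,_)
  open import Data.Sum.Base using (inj₁; inj₂)
  open import Data.Empty using (⊥-elim)
  open import Relation.Nullary using (¬_)
  open import Relation.Binary.PropositionalEquality

  prime⇒>1 : ∀ {p} → Prime p → 1 < p
  prime⇒>1 {p} p-prime = nonTrivial⇒n>1 p {{prime⇒nonTrivial p-prime}}

  ∃-prime-divisor : ∀ {n} → 1 < n → ∃ λ q → Prime q × q ∣ n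
  ∃-prime-divisor {suc zero} (s≤s ())
  ∃-prime-divisor {n@(suc (suc _))} _ with factorise n
  ... | record { factors = [] ; isFactorisation = () }
  ... | record { factors = q ∷ qs ; isFactorisation = eq ; factorsPrime = q-prime ∷ _ } =
    q , q-prime , divides (product qs) (trans eq (*-comm q (product qs)))

  ∣! : ∀ {q n} → 0 < q → q ≤ n → q ∣ n !
  ∣! {suc q} _ q≤n = ∣-trans (m∣m*n (q !)) (m≤n⇒m!∣n! q≤n)

  module _ {p} (p-prime : Prime p) where

    ∤1 : ¬ p ∣ 1
    ∤1 p∣1 = <-irrefl (sym (∣1⇒≡1 p∣1)) (prime⇒>1 p-prime)

    ∤-* : ∀ {m n} → ¬ p ∣ m → ¬ p ∣ n → ¬ p ∣ m * n
    ∤-* {m} {n} p∤m p∤n p∣mn with euclidsLemma m n p-prime p∣mn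
    ... | inj₁ p∣m = p∤m p∣m
    ... | inj₂ p∣n = p∤n p∣n

    ∤-< : ∀ {m} → 0 < m → m < p → ¬ p ∣ m
    ∤-< {suc _} _ m<p p∣m = <⇒≱ m<p (∣⇒≤ p∣m)

    ∤-! : ∀ {m} → m < p → ¬ p ∣ m !
    ∤-! {zero}  _   = ∤1
    ∤-! {suc m} m<p = ∤-* (∤-< z<s m<p) (∤-! (<-trans (n<1+n m) m<p))

    ∤-^ : ∀ {m} e → ¬ p ∣ m → ¬ p ∣ m ^ e
    ∤-^ zero    _   = ∤1
    ∤-^ (suc e) p∤m = ∤-* p∤m (∤-^ e p∤m)

    ∤⇒coprime : ∀ {n} → ¬ p ∣ n → Coprime p n
    ∤⇒coprime p∤n (d∣p , d∣n) with prime⇒irreducible p-prime d∣p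
    ... | inj₁ d≡1    = d≡1
    ... | inj₂ refl   = ⊥-elim (p∤n d∣n)

module Valuation {p} (p-prime : Prime p) where

  open import Data.Nat.Base
  open import Data.Nat.Properties
  open import Data.Nat.Divisibility
  open import Data.Nat.DivMod using (_/_; _%_; m≡m%n+[m/n]*n; m%n<n; m/n<m; m<n*o⇒m/o<n)
  open import Data.Nat.Induction using (<-rec)
  open import Data.Nat.Primality using (prime⇒nonZero)
  open import Data.Product.Base using (∃; ∃₂; _×_; _,_)
  open import Data.Sum.Base using (_⊎_; inj₁; inj₂)
  open import Data.Empty using (⊥-elim)
  open import Relation.Nullary using (¬_; yes; no)
  open import Relation.Binary.PropositionalEquality
  open import Relation.Binary.Definitions using (tri<; tri≈; tri>)
  open import Data.Nat.Tactic.RingSolver using (solve-∀)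
  open Primes
  open Binomial

  instance
    p≢0 : NonZero p
    p≢0 = prime⇒nonZero p-prime

  1<p : 1 < p
  1<p = prime⇒>1 p-prime

  record ExactPower (a n : ℕ) : Set where
    constructor exact
    field
      cofactor      : ℕ
      factorisation : n ≡ p ^ a * cofactor
      ∤cofactor     : ¬ p ∣ cofactor

  exactPower-coprime : ∀ {u} → ¬ p ∣ u → ExactPower 0 u
  exactPower-coprime {u} p∤u = exact u (sym (+-identityʳ u)) p∤u

  exactPower-p^ : ∀ a → ExactPower a (p ^ a)
  exactPower-p^ a = exact 1 (sym (*-identityʳ _)) (∤1 p-prime)

  exactPower-* : ∀ {a b m n} → ExactPower a m → ExactPower b n → ExactPower (a + b) (m * n)
  exactPower-* {a} {b} (exact u refl p∤u) (exact w refl p∤w) =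
    exact (u * w) (trans (regroup (p ^ a) (p ^ b) u w) (cong (_* (u * w)) (sym (^-distribˡ-+-* p a b))))
          (∤-* p-prime p∤u p∤w)
    where
    regroup : ∀ x y u w → x * u * (y * w) ≡ x * y * (u * w)
    regroup = solve-∀

  exactPower-*p : ∀ {a n} → ExactPower a n → ExactPower (suc a) (n * p)
  exactPower-*p {a} (exact u refl p∤u) = exact u (regroup (p ^ a) u p) p∤u
    where
    regroup : ∀ x u p → x * u * p ≡ p * x * u
    regroup = solve-∀

  p∣lower-cofactor : ∀ {a b u w} → a < b → p ^ a * u ≡ p ^ b * w → p ∣ u
  p∣lower-cofactor {a} {b} {u} {w} a<b eq =
    divides (p ^ c * w) (*-cancelˡ-≡ u (p ^ c * w * p) (p ^ a) {{m^n≢0 p a}} (begin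
      p ^ a * u               ≡⟨ eq ⟩
      p ^ b * w               ≡⟨ cong (λ n → p ^ n * w) a+[1+c]≡b ⟨
      p ^ (a + suc c) * w     ≡⟨ cong (_* w) (^-distribˡ-+-* p a (suc c)) ⟩
      p ^ a * (p * p ^ c) * w ≡⟨ regroup (p ^ a) p (p ^ c) w ⟩
      p ^ a * (p ^ c * w * p) ∎))
    where
    open ≡-Reasoning
    c = b ∸ suc a
    a+[1+c]≡b : a + suc c ≡ b
    a+[1+c]≡b = trans (+-suc a c) (m+[n∸m]≡n a<b)
    regroup : ∀ x p y w → x * (p * y) * w ≡ x * (y * w * p)
    regroup = solve-∀

  exactPower-unique : ∀ {a b n} → ExactPower a n → ExactPower b n → a ≡ b
  exactPower-unique {a} {b} (exact u refl p∤u) (exact w eq p∤w) with <-cmp a b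
  ... | tri< a<b _ _ = ⊥-elim (p∤u (p∣lower-cofactor a<b eq))
  ... | tri≈ _ a≡b _ = a≡b
  ... | tri> _ _ b<a = ⊥-elim (p∤w (p∣lower-cofactor b<a (sym eq)))

  exactPower-exists : ∀ n → 0 < n → ∃ λ a → ExactPower a n
  exactPower-exists = <-rec _ step
    where
    step : ∀ n → (∀ {m} → m < n → 0 < m → ∃ λ a → ExactPower a m) → 0 < n → ∃ λ a → ExactPower a n
    step n rec n>0 with p ∣? n
    ... | no p∤n = 0 , exactPower-coprime p∤n
    ... | yes (divides q refl) with rec (m<m*n q p {{q≢0}} 1<p) (>-nonZero⁻¹ q {{q≢0}})
      where
      q≢0 : NonZero q
      q≢0 = m*n≢0⇒m≢0 q {{>-nonZero n>0}}
    ...   | a , q-exact = suc a , exactPower-*p q-exact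

  exactPower[1]⇒0 : ∀ {a} → ExactPower a 1 → a ≡ 0
  exactPower[1]⇒0 a-exact = exactPower-unique a-exact (exactPower-coprime (∤1 p-prime))

  factorial-split : ∀ q r → r < p → ∃ λ R → (q * p + r) ! ≡ p ^ q * q ! * R × ¬ p ∣ R
  factorial-split zero    zero    _   = 1 , refl , ∤1 p-prime
  factorial-split (suc q) zero    _   with factorial-split q (pred p) (≤-reflexive (suc-pred p))
  ... | R , eq , p∤R = R , eq′ , p∤R
    where
    open ≡-Reasoning
    [q+1]p≡ : suc (q * p + pred p) ≡ suc q * p
    [q+1]p≡ = trans (sym (+-suc (q * p) (pred p))) (trans (cong (q * p +_) (suc-pred p)) (+-comm (q * p) p))
    regroup : ∀ n p x f R → n * p * (x * f * R) ≡ p * x * (n * f) * R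
    regroup = solve-∀
    eq′ : (suc q * p + 0) ! ≡ p ^ suc q * suc q ! * R
    eq′ = begin
      (suc q * p + 0) !                         ≡⟨ cong _! (trans (+-identityʳ _) (sym [q+1]p≡)) ⟩
      suc (q * p + pred p) * (q * p + pred p) ! ≡⟨ cong₂ _*_ [q+1]p≡ eq ⟩
      suc q * p * (p ^ q * q ! * R)             ≡⟨ regroup (suc q) p (p ^ q) (q !) R ⟩
      p ^ suc q * suc q ! * R                   ∎
  factorial-split q       (suc r) r<p with factorial-split q r (<-trans (n<1+n r) r<p)
  ... | R , eq , p∤R = n * R , eq′ , ∤-* p-prime p∤n p∤R
    where
    open ≡-Reasoning
    n = suc (q * p + r)
    p∤n : ¬ p ∣ n
    p∤n p∣n = ∤-< p-prime z<s r<p (∣m+n∣m⇒∣n (subst (p ∣_) (sym (+-suc (q * p) r)) p∣n) (n∣m*n q))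
    regroup : ∀ n x f R → n * (x * f * R) ≡ x * f * (n * R)
    regroup = solve-∀
    eq′ : (q * p + suc r) ! ≡ p ^ q * q ! * (n * R)
    eq′ = begin
      (q * p + suc r) !        ≡⟨ cong _! (+-suc (q * p) r) ⟩
      n * (q * p + r) !        ≡⟨ cong (n *_) eq ⟩
      n * (p ^ q * q ! * R)    ≡⟨ regroup n (p ^ q) (q !) R ⟩
      p ^ q * q ! * (n * R)    ∎

  legendre : ∀ q r {a b} → r < p → ExactPower a ((q * p + r) !) → ExactPower b (q !) → a ≡ q + b
  legendre q r {b = b} r<p a-exact b-exact with factorial-split q r r<p
  ... | R , eq , p∤R = trans (exactPower-unique a-exact split-exact) (cong (q +_) (+-identityʳ b))
    where
    split-exact : ExactPower (q + (b + 0)) ((q * p + r) !)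
    split-exact = subst (ExactPower _) (sym (trans eq (*-assoc (p ^ q) (q !) R)))
      (exactPower-* (exactPower-p^ q) (exactPower-* b-exact (exactPower-coprime p∤R)))

  carry : ∀ r δ → r < p → δ ≤ 1 → ∃₂ λ c r′ → c ≤ 1 × r′ < p × r + r + δ ≡ c * p + r′
  carry r δ r<p δ≤1 =
    s / p , s % p , ≤-pred (m<n*o⇒m/o<n s<2p) , m%n<n s p , trans (m≡m%n+[m/n]*n s p) (+-comm (s % p) _)
    where
    s = r + r + δ
    s<2p : s < 2 * p
    s<2p = begin-strict
      r + r + δ     ≤⟨ +-monoʳ-≤ (r + r) δ≤1 ⟩
      r + r + 1     ≡⟨ +-comm (r + r) 1 ⟩
      suc (r + r)   <⟨ s<s (+-monoʳ-< r (n<1+n r)) ⟩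
      suc r + suc r ≤⟨ +-mono-≤ r<p (subst (suc r ≤_) (sym (+-identityʳ p)) r<p) ⟩
      2 * p         ∎
      where open ≤-Reasoning

  excess-bound : ∀ {q c e n} → c ≤ 1 → (q + q + c) * p ≤ n → e ≡ 0 ⊎ p ^ e ≤ q + q + c →
                 c + e ≡ 0 ⊎ p ^ (c + e) ≤ n
  excess-bound {q} z≤n       _  (inj₁ e≡0) = inj₁ e≡0
  excess-bound {q} z≤n       le (inj₂ p^e≤) = inj₂ (≤-trans p^e≤ (≤-trans (m≤m*n (q + q + 0) p) le))
  excess-bound {q} (s≤s z≤n) le bound =
    inj₂ (≤-trans (*-monoʳ-≤ p (p^e≤ bound)) (≤-trans (≤-reflexive (*-comm p _)) le))
    where
    p^e≤ : ∀ {e} → e ≡ 0 ⊎ p ^ e ≤ q + q + 1 → p ^ e ≤ q + q + 1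
    p^e≤ (inj₁ refl) = m≤n+m 1 (q + q)
    p^e≤ (inj₂ le)   = le

  -- e counts the carries in the base-p addition m + m + δ (Kummer), whence the bound on p ^ e
  ValuationExcess : ℕ → Set
  ValuationExcess m = ∀ δ → δ ≤ 1 → ∀ {a b} → ExactPower a ((m + m + δ) !) → ExactPower b (m !) →
                      ∃ λ e → a ≡ b + b + e × (e ≡ 0 ⊎ p ^ e ≤ m + m + δ)

  valuation-excess : ∀ m → ValuationExcess m
  valuation-excess = <-rec ValuationExcess step
    where
    step : ∀ m → (∀ {q} → q < m → ValuationExcess q) → ValuationExcess m
    step zero _ δ δ≤1 {a} {b} a-exact b-exact =
      0 , trans (exactPower[1]⇒0 (subst (ExactPower a) (δ!≡1 δ≤1) a-exact))
                (cong (λ b → b + b + 0) (sym (exactPower[1]⇒0 b-exact))) , inj₁ refl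
      where
      δ!≡1 : ∀ {δ} → δ ≤ 1 → δ ! ≡ 1
      δ!≡1 z≤n       = refl
      δ!≡1 (s≤s z≤n) = refl
    step m@(suc _) rec δ δ≤1 {a} {b} a-exact b-exact
      with carry (m % p) δ (m%n<n m p) δ≤1
         | exactPower-exists ((m / p) !) (1≤n! (m / p))
    ... | c , r′ , c≤1 , r′<p , carry-eq | b′ , q!-exact
      with exactPower-exists ((m / p + m / p + c) !) (1≤n! (m / p + m / p + c))
    ... | a′ , a′-exact
      with rec (m/n<m m p 1<p) c c≤1 a′-exact q!-exact
    ... | e′ , a′≡ , bound′ =
      c + e′ , a≡ , excess-bound {m / p} c≤1 (≤-trans (m≤m+n _ r′) (≤-reflexive (sym 2m+δ≡))) bound′
      where
      open ≡-Reasoning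
      q = m / p
      r = m % p
      m≡ : m ≡ q * p + r
      m≡ = trans (m≡m%n+[m/n]*n m p) (+-comm r (q * p))
      2m+δ≡ : m + m + δ ≡ (q + q + c) * p + r′
      2m+δ≡ = begin
        m + m + δ                         ≡⟨ cong (λ m → m + m + δ) m≡ ⟩
        (q * p + r) + (q * p + r) + δ     ≡⟨ regroup q p r δ ⟩
        (q + q) * p + (r + r + δ)         ≡⟨ cong ((q + q) * p +_) carry-eq ⟩
        (q + q) * p + (c * p + r′)        ≡⟨ collect q c p r′ ⟩
        (q + q + c) * p + r′              ∎
        where
        regroup : ∀ q p r δ → (q * p + r) + (q * p + r) + δ ≡ (q + q) * p + (r + r + δ)
        regroup = solve-∀
        collect : ∀ q c p r′ → (q + q) * p + (c * p + r′) ≡ (q + q + c) * p + r′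
        collect = solve-∀
      b≡ : b ≡ q + b′
      b≡ = legendre q r (m%n<n m p) (subst (λ n → ExactPower b (n !)) m≡ b-exact) q!-exact
      a≡ : a ≡ b + b + (c + e′)
      a≡ = begin
        a                              ≡⟨ legendre (q + q + c) r′ r′<p (subst (λ n → ExactPower a (n !)) 2m+δ≡ a-exact) a′-exact ⟩
        q + q + c + a′                 ≡⟨ cong (q + q + c +_) a′≡ ⟩
        q + q + c + (b′ + b′ + e′)     ≡⟨ regroup q c b′ e′ ⟩
        (q + b′) + (q + b′) + (c + e′) ≡⟨ cong (λ b → b + b + (c + e′)) b≡ ⟨
        b + b + (c + e′)               ∎
        where
        regroup : ∀ q c b e → q + q + c + (b + b + e) ≡ (q + b) + (q + b) + (c + e)
        regroup = solve-∀

  p^∣binomial⇒≤ : ∀ m → 0 < m → ∀ f → p ^ f ∣ binomial m m → p ^ f ≤ m + m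
  p^∣binomial⇒≤ m m>0 f (divides h N≡)
    with exactPower-exists h (>-nonZero⁻¹ h {{h≢0}})
       | exactPower-exists (m !) (1≤n! m)
       | exactPower-exists ((m + m + 0) !) (1≤n! (m + m + 0))
    where
    h≢0 : NonZero h
    h≢0 = m*n≢0⇒m≢0 h {{subst NonZero N≡ (>-nonZero (binomial>0 m m))}}
  ... | g , h-exact | b , m!-exact | a , 2m!-exact with valuation-excess m 0 z≤n 2m!-exact m!-exact
  ... | e , a≡ , bound = begin
    p ^ f      ≤⟨ ^-monoʳ-≤ p (subst (f ≤_) f+g≡e (m≤m+n f g)) ⟩
    p ^ e      ≤⟨ p^e≤ bound ⟩
    m + m + 0  ≡⟨ +-identityʳ (m + m) ⟩
    m + m      ∎
    where
    open ≤-Reasoning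
    2m!≡ : p ^ f * h * (m ! * m !) ≡ (m + m + 0) !
    2m!≡ = trans (cong (_* (m ! * m !)) (trans (*-comm (p ^ f) h) (sym N≡)))
                 (trans (binomial-*-!*! m m) (cong _! (sym (+-identityʳ (m + m)))))
    product-exact : ExactPower (f + g + (b + b)) ((m + m + 0) !)
    product-exact = subst (ExactPower _) 2m!≡
      (exactPower-* (exactPower-* (exactPower-p^ f) h-exact) (exactPower-* m!-exact m!-exact))
    f+g≡e : f + g ≡ e
    f+g≡e = +-cancelʳ-≡ (b + b) (f + g) e
      (trans (exactPower-unique product-exact 2m!-exact) (trans a≡ (+-comm (b + b) e)))
    p^e≤ : e ≡ 0 ⊎ p ^ e ≤ m + m + 0 → p ^ e ≤ m + m + 0
    p^e≤ (inj₁ refl) = ≤-trans m>0 (≤-trans (m≤m+n m m) (m≤m+n (m + m) 0))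
    p^e≤ (inj₂ le)   = le

module Primorial where

  open import Data.Nat.Base
  open import Data.Nat.Properties
  open import Data.Nat.Divisibility
  open import Data.Nat.Induction using (<-rec)
  open import Data.Nat.Primality
  open import Data.Nat.Coprimality using (Coprime; coprime-divisor)
  import Data.Nat.Coprimality as Coprimality
  open import Data.Sum.Base using (inj₁; inj₂; [_,_]′)
  open import Function.Base using (id)
  open import Data.Empty using (⊥-elim)
  open import Relation.Nullary using (¬_; Dec; yes; no)
  open import Relation.Binary.PropositionalEquality
  open import Data.Nat.Tactic.RingSolver using (solve-∀)
  open Primes
  open Binomial

  -- taking the decision as an argument lets `with prime? j` unfold primorial and primesIn
  primeOr1 : ∀ j → Dec (Prime j) → ℕ
  primeOr1 j (yes _) = j
  primeOr1 j (no _)  = 1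

  primorial : ℕ → ℕ
  primorial zero    = 1
  primorial (suc y) = primorial y * primeOr1 (suc y) (prime? (suc y))

  primesIn : ℕ → ℕ → ℕ
  primesIn a zero    = 1
  primesIn a (suc n) = primesIn a n * primeOr1 (suc (a + n)) (prime? (suc (a + n)))

  primorial-+ : ∀ a n → primorial (a + n) ≡ primorial a * primesIn a n
  primorial-+ a zero    = trans (cong primorial (+-identityʳ a)) (sym (*-identityʳ _))
  primorial-+ a (suc n) = begin
    primorial (a + suc n)                   ≡⟨ cong primorial (+-suc a n) ⟩
    primorial (a + n) * f                   ≡⟨ cong (_* f) (primorial-+ a n) ⟩
    primorial a * primesIn a n * f          ≡⟨ *-assoc (primorial a) (primesIn a n) f ⟩
    primorial a * primesIn a (suc n)        ∎
    where
    open ≡-Reasoning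
    f = primeOr1 (suc (a + n)) (prime? (suc (a + n)))

  ∤primorial : ∀ {q} → Prime q → ∀ y → y < q → ¬ q ∣ primorial y
  ∤primorial q-prime zero    _   = ∤1 q-prime
  ∤primorial q-prime (suc y) y<q with prime? (suc y)
  ... | yes _ = ∤-* q-prime (∤primorial q-prime y (<-trans (n<1+n y) y<q)) (∤-< q-prime z<s y<q)
  ... | no  _ = ∤-* q-prime (∤primorial q-prime y (<-trans (n<1+n y) y<q)) (∤1 q-prime)

  coprime⇒*-∣ : ∀ {u v x} → Coprime u v → u ∣ x → v ∣ x → u * v ∣ x
  coprime⇒*-∣ {u} {v} u⊥v u∣x (divides w refl) with coprime-divisor u⊥v (subst (u ∣_) (*-comm w v) u∣x)
  ... | divides w′ refl = divides w′ (*-assoc w′ u v)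

  primesIn-∣ : ∀ a n {x} → (∀ q → Prime q → a < q → q ≤ a + n → q ∣ x) → primesIn a n ∣ x
  primesIn-∣ a zero    _      = 1∣ _
  primesIn-∣ a (suc n) {x} q∣x =
    extend (primesIn-∣ a n λ q q-prime a<q q≤a+n → q∣x q q-prime a<q (≤-trans q≤a+n (+-monoʳ-≤ a (n≤1+n n))))
    where
    extend : primesIn a n ∣ x → primesIn a (suc n) ∣ x
    extend IH with prime? (suc (a + n))
    ... | no  _       = subst (_∣ x) (sym (*-identityʳ _)) IH
    ... | yes q-prime = coprime⇒*-∣ coprime IH (q∣x _ q-prime (s≤s (m≤m+n a n)) (≤-reflexive (sym (+-suc a n))))
      where
      coprime : Coprime (primesIn a n) (suc (a + n))
      coprime = Coprimality.sym (∤⇒coprime q-prime λ q∣ →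
        ∤primorial q-prime (a + n) ≤-refl (∣-trans q∣ (divides (primorial a) (primorial-+ a n))))

  primesIn∣binomial : ∀ k → primesIn (suc k) k ∣ binomial k (suc k)
  primesIn∣binomial k = primesIn-∣ (suc k) k q∣binomial
    where
    q∣binomial : ∀ q → Prime q → suc k < q → q ≤ suc k + k → q ∣ binomial k (suc k)
    q∣binomial q q-prime k+1<q q≤2k+1 = [ id , (λ q∣!! → ⊥-elim (q∤!! q∣!!)) ]′
      (euclidsLemma (binomial k (suc k)) (k ! * suc k !) q-prime
        (subst (q ∣_) (sym (binomial-*-!*! k (suc k)))
          (∣! (<-trans z<s k+1<q) (≤-trans q≤2k+1 (≤-reflexive (sym (+-suc k k)))))))
      where
      q∤!! : ¬ q ∣ k ! * suc k !
      q∤!! = ∤-* q-prime (∤-! q-prime (<-trans (n<1+n k) k+1<q)) (∤-! q-prime k+1<q)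

  data ParityView : ℕ → Set where
    even : ∀ k → ParityView (k + k)
    odd  : ∀ k → ParityView (suc (k + k))

  parityView : ∀ n → ParityView n
  parityView zero = even 0
  parityView (suc n) with parityView n
  ... | even k = odd k
  ... | odd  k = subst ParityView (cong suc (+-suc k k)) (even (suc k))

  even>2⇒¬prime : ∀ k → ¬ Prime (suc (suc k) + suc (suc k))
  even>2⇒¬prime k k+k-prime with prime⇒irreducible k+k-prime (divides (suc (suc k)) (double k))
    where
    double : ∀ k → suc (suc k) + suc (suc k) ≡ suc (suc k) * 2
    double = solve-∀
  ... | inj₁ ()
  ... | inj₂ 2≡ = 0≢1+n (trans (suc-injective (suc-injective 2≡)) (+-suc k (suc k)))

  primorial≤8^ : ∀ y → primorial y ≤ 2 ^ (3 * y)
  primorial≤8^ = <-rec _ step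
    where
    step : ∀ y → (∀ {z} → z < y → primorial z ≤ 2 ^ (3 * z)) → primorial y ≤ 2 ^ (3 * y)
    step y rec with parityView y
    ... | even zero          = ≤-refl
    ... | odd zero           = s≤s z≤n
    ... | even (suc zero)    = s≤s (s≤s z≤n)
    ... | even (suc (suc k)) with prime? (suc (suc (k + suc (suc k))))
    ...   | yes y-prime = ⊥-elim (even>2⇒¬prime k y-prime)
    ...   | no  _       = begin
      primorial z * 1 ≡⟨ *-identityʳ _ ⟩
      primorial z     ≤⟨ rec (n<1+n z) ⟩
      2 ^ (3 * z)     ≤⟨ ^-monoʳ-≤ 2 (*-monoʳ-≤ 3 (n≤1+n z)) ⟩
      2 ^ (3 * suc z) ∎
      where
      open ≤-Reasoning
      z = suc (k + suc (suc k))
    step y rec | odd (suc k) = begin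
      primorial (suc (suc k) + suc k)                          ≡⟨ primorial-+ (suc (suc k)) (suc k) ⟩
      primorial (suc (suc k)) * primesIn (suc (suc k)) (suc k) ≤⟨ *-mono-≤ (rec (s≤s (s≤s (m≤n+m (suc k) k)))) primesIn≤ ⟩
      2 ^ (3 * suc (suc k)) * 2 ^ (suc k + suc (suc k))        ≡⟨ ^-distribˡ-+-* 2 (3 * suc (suc k)) _ ⟨
      2 ^ (3 * suc (suc k) + (suc k + suc (suc k)))            ≤⟨ ^-monoʳ-≤ 2 (≤-trans (m≤m+n _ k) (≤-reflexive (exponents k))) ⟩
      2 ^ (3 * suc (suc k + suc k))                            ∎
      where
      open ≤-Reasoning
      primesIn≤ : primesIn (suc (suc k)) (suc k) ≤ 2 ^ (suc k + suc (suc k))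
      primesIn≤ = ≤-trans (∣⇒≤ {{>-nonZero (binomial>0 (suc k) (suc (suc k)))}} (primesIn∣binomial (suc k)))
                          (binomial≤2^[a+b] (suc k) (suc (suc k)))
      exponents : ∀ k → 3 * suc (suc k) + (suc k + suc (suc k)) + k ≡ 3 * suc (suc k + suc k)
      exponents = solve-∀

module Bertrand where

  open import Data.Nat.Base
  open import Data.Nat.Properties
  open import Data.Nat.Divisibility
  open import Data.Nat.Primality
  open import Data.Product.Base using (∃; _×_; _,_)
  open import Data.Empty using (⊥-elim)
  open import Data.Sum.Base using (inj₁; inj₂)
  open import Relation.Nullary using (¬_; Dec; yes; no)
  open import Relation.Nullary.Decidable using (_×-dec_)
  open import Relation.Binary.PropositionalEquality
  open import Data.Nat.Tactic.RingSolver using (solve-∀)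
  open import Data.Nat.DivMod using (m/n<m; m/n*n≤m; /-monoˡ-≤; m≡m%n+[m/n]*n; m%n<n)
  open import Data.Nat.Induction using (<-rec)
  open Primes
  open Binomial
  open Primorial

  record PowerSmooth (y B n : ℕ) : Set where
    field
      prime≤      : ∀ {q} → Prime q → q ∣ n → q ≤ y
      primePower≤ : ∀ {q} f → Prime q → q ^ f ∣ n → q ^ f ≤ B

  open PowerSmooth

  powerSmooth-pred : ∀ {y B n} → (∀ {q} → Prime q → q ∣ n → q ≢ suc y) →
                     PowerSmooth (suc y) B n → PowerSmooth y B n
  powerSmooth-pred q≢1+y s .prime≤ q-prime q∣n with m≤n⇒m<n∨m≡n (prime≤ s q-prime q∣n)
  ... | inj₁ q<1+y = s≤s⁻¹ q<1+y
  ... | inj₂ q≡1+y = ⊥-elim (q≢1+y q-prime q∣n q≡1+y)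
  powerSmooth-pred q≢1+y s .primePower≤ = primePower≤ s

  powerSmooth-∣ : ∀ {y B m n} → m ∣ n → PowerSmooth y B n → PowerSmooth y B m
  powerSmooth-∣ m∣n s .prime≤      q-prime q∣m  = prime≤ s q-prime (∣-trans q∣m m∣n)
  powerSmooth-∣ m∣n s .primePower≤ f q-prime qᶠ∣m = primePower≤ s f q-prime (∣-trans qᶠ∣m m∣n)

  module _ {B R} (1≤B : 1 ≤ B) (√B≤R : ∀ j → j * j ≤ B → j ≤ R) where

    instance
      B≢0 : NonZero B
      B≢0 = >-nonZero 1≤B

    p^a≤p : ∀ {y n p} a → Prime p → R < p → PowerSmooth y B n → p ^ a ∣ n → p ^ a ≤ p
    p^a≤p             zero          p-prime _   _ _ = <-trans z<s (prime⇒>1 p-prime)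
    p^a≤p {p = p}     (suc zero)    _       _   _ _ = ≤-reflexive (*-identityʳ p)
    p^a≤p {n = n} {p} (suc (suc a)) p-prime R<p s p^a∣n =
      ⊥-elim (<⇒≱ R<p (√B≤R p (subst (_≤ B) (cong (p *_) (*-identityʳ p)) (primePower≤ s 2 p-prime p²∣n))))
      where
      p²∣n : p ^ 2 ∣ n
      p²∣n = ∣-trans (divides (p ^ a) (trans (^-distribˡ-+-* p 2 a) (*-comm (p ^ 2) (p ^ a)))) p^a∣n

    smooth-bound-step : ∀ {y u} a → Prime (suc y) → PowerSmooth (suc y) B (suc y ^ a * u) →
                        u ≤ B ^ (y ⊓ R) * primorial y → suc y ^ a * u ≤ B ^ (suc y ⊓ R) * (primorial y * suc y)
    smooth-bound-step {y} {u} a p-prime s u-bound with suc y ≤? R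
    ... | yes p≤R = begin
      p ^ a * u                       ≤⟨ *-mono-≤ (primePower≤ s a p-prime (m∣m*n u)) u-bound ⟩
      B * (B ^ (y ⊓ R) * primorial y) ≡⟨ cong (λ k → B * (B ^ k * primorial y)) (m≤n⇒m⊓n≡m (<⇒≤ p≤R)) ⟩
      B * (B ^ y * primorial y)       ≡⟨ *-assoc B (B ^ y) (primorial y) ⟨
      B ^ p * primorial y             ≤⟨ *-monoʳ-≤ (B ^ p) (m≤m*n (primorial y) p) ⟩
      B ^ p * (primorial y * p)       ≡⟨ cong (λ k → B ^ k * (primorial y * p)) (m≤n⇒m⊓n≡m p≤R) ⟨
      B ^ (p ⊓ R) * (primorial y * p) ∎
      where
      open ≤-Reasoning
      p = suc y
    ... | no p≰R = begin
      p ^ a * u                       ≤⟨ *-mono-≤ (p^a≤p a p-prime (≰⇒> p≰R) s (m∣m*n u)) u-bound ⟩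
      p * (B ^ (y ⊓ R) * primorial y) ≤⟨ *-monoʳ-≤ p (*-monoˡ-≤ (primorial y) (^-monoʳ-≤ B (⊓-monoˡ-≤ R (n≤1+n y)))) ⟩
      p * (B ^ (p ⊓ R) * primorial y) ≡⟨ rotate p (B ^ (p ⊓ R)) (primorial y) ⟩
      B ^ (p ⊓ R) * (primorial y * p) ∎
      where
      open ≤-Reasoning
      p = suc y
      rotate : ∀ x b q → x * (b * q) ≡ b * (q * x)
      rotate = solve-∀

    smooth-bound : ∀ y n → 0 < n → PowerSmooth y B n → n ≤ B ^ (y ⊓ R) * primorial y
    smooth-bound zero (suc zero) _ _ = ≤-refl
    smooth-bound zero n@(suc (suc _)) _ s with ∃-prime-divisor {n} (s≤s (s≤s z≤n))
    ... | q , q-prime , q∣n = ⊥-elim (<⇒≱ (prime⇒>1 q-prime) (≤-trans (prime≤ s q-prime q∣n) z≤n))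
    smooth-bound (suc y) n n>0 s with prime? (suc y)
    ... | no ¬prime = begin
      n                             ≤⟨ smooth-bound y n n>0 (powerSmooth-pred (λ q-prime _ q≡p → ¬prime (subst Prime q≡p q-prime)) s) ⟩
      B ^ (y ⊓ R) * primorial y     ≤⟨ *-monoˡ-≤ (primorial y) (^-monoʳ-≤ B (⊓-monoˡ-≤ R (n≤1+n y))) ⟩
      B ^ (suc y ⊓ R) * primorial y ≡⟨ cong (B ^ (suc y ⊓ R) *_) (*-identityʳ (primorial y)) ⟨
      B ^ (suc y ⊓ R) * (primorial y * 1) ∎
      where open ≤-Reasoning
    ... | yes p-prime with Valuation.exactPower-exists p-prime n n>0
    ... | a , Valuation.exact u refl p∤u = smooth-bound-step a p-prime s (smooth-bound y u u>0 u-smooth)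
      where
      u>0 : 0 < u
      u>0 = >-nonZero⁻¹ u {{m*n≢0⇒n≢0 (suc y ^ a) {{>-nonZero n>0}}}}
      u-smooth : PowerSmooth y B u
      u-smooth = powerSmooth-pred (λ _ q∣u q≡p → p∤u (subst (_∣ u) q≡p q∣u)) (powerSmooth-∣ (n∣m*n (suc y ^ a)) s)

  prime∣binomial⇒≤ : ∀ {q} a b → Prime q → q ∣ binomial a b → q ≤ a + b
  prime∣binomial⇒≤ {q} a b q-prime q∣N with q ≤? a + b
  ... | yes q≤a+b = q≤a+b
  ... | no  q≰a+b = ⊥-elim (∤-! q-prime (≰⇒> q≰a+b)
    (subst (q ∣_) (binomial-*-!*! a b) (∣m⇒∣m*n (a ! * b !) q∣N)))

  2i+10<13*2^i : ∀ i → i + i + 10 < 13 * 2 ^ i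
  2i+10<13*2^i zero    = m≤m+n 11 2
  2i+10<13*2^i (suc i) = begin-strict
    suc i + suc i + 10      ≡⟨ shift i ⟩
    (i + i + 10) + 2        <⟨ +-monoˡ-< 2 (2i+10<13*2^i i) ⟩
    13 * 2 ^ i + 2          ≤⟨ +-monoʳ-≤ (13 * 2 ^ i) (≤-trans (s≤s (s≤s z≤n)) (m≤m*n 13 (2 ^ i) {{m^n≢0 2 i}})) ⟩
    13 * 2 ^ i + 13 * 2 ^ i ≡⟨ double (2 ^ i) ⟩
    13 * 2 ^ suc i          ∎
    where
    open ≤-Reasoning
    shift : ∀ i → suc i + suc i + 10 ≡ (i + i + 10) + 2
    shift = solve-∀
    double : ∀ t → 13 * t + 13 * t ≡ 13 * (2 * t)
    double = solve-∀

  bertrand-exponent : ∀ i → (i + i + 10) * 2 ^ (i + 5) + 3 * 2 ^ (i + i + 5) < 2 ^ (i + i + 9)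
  bertrand-exponent i = begin-strict
    (i + i + 10) * 2 ^ (i + 5) + 3 * 2 ^ (i + i + 5)
      ≡⟨ cong₂ (λ a b → (i + i + 10) * a + 3 * b) (^-distribˡ-+-* 2 i 5) (2^[2i+k] 5) ⟩
    (i + i + 10) * (t * 32) + 3 * (t * t * 32)
      <⟨ +-monoˡ-< (3 * (t * t * 32)) (*-monoˡ-< (t * 32) {{m*n≢0 t 32 {{m^n≢0 2 i}}}} (2i+10<13*2^i i)) ⟩
    13 * t * (t * 32) + 3 * (t * t * 32)
      ≡⟨ collect t ⟩
    t * t * 512
      ≡⟨ 2^[2i+k] 9 ⟨
    2 ^ (i + i + 9)
      ∎
    where
    open ≤-Reasoning
    t = 2 ^ i
    2^[2i+k] : ∀ k → 2 ^ (i + i + k) ≡ t * t * 2 ^ k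
    2^[2i+k] k = trans (^-distribˡ-+-* 2 (i + i) k) (cong (_* 2 ^ k) (^-distribˡ-+-* 2 i i))
    collect : ∀ t → 13 * t * (t * 32) + 3 * (t * t * 32) ≡ t * t * 512
    collect = solve-∀

  -- If no prime lies in (y, 2m] with y = 2m / 32, every prime factor of (2m choose m) is at most y,
  -- so smooth-bound and primorial≤8^ give (2m choose m) ≤ (2m) ^ √(2m) · 8 ^ y < 2 ^ m.
  bertrand-weak : ∀ i → ∃ λ p → Prime p × 2 ^ (i + i + 5) < p × p ≤ 2 ^ (i + i + 10)
  bertrand-weak i = search (anyUpTo? (λ q → prime? q ×-dec y <? q) (suc B))
    where
    y = 2 ^ (i + i + 5)
    m = 2 ^ (i + i + 9)
    B = 2 ^ (i + i + 10)
    R = 2 ^ (i + 5)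
    N = binomial m m
    E = (i + i + 10) * R + 3 * y
    B≡m+m : B ≡ m + m
    B≡m+m = trans (cong (2 ^_) (+-suc (i + i) 9)) (cong (m +_) (+-identityʳ m))
    R*R≡B : R * R ≡ B
    R*R≡B = trans (sym (^-distribˡ-+-* 2 (i + 5) (i + 5))) (cong (2 ^_) (exponent i))
      where
      exponent : ∀ i → i + 5 + (i + 5) ≡ i + i + 10
      exponent = solve-∀
    √B≤R : ∀ j → j * j ≤ B → j ≤ R
    √B≤R j j*j≤B with R <? j
    ... | yes R<j = ⊥-elim (<⇒≱ (subst (_< j * j) R*R≡B (*-mono-< R<j R<j)) j*j≤B)
    ... | no  R≮j = ≮⇒≥ R≮j
    2^E<N : 2 ^ E < N
    2^E<N = <-≤-trans (^-monoʳ-< 2 (s≤s (s≤s z≤n)) (bertrand-exponent i)) (2^m≤binomial[m,m] m)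
    N≤2^E : PowerSmooth y B N → N ≤ 2 ^ E
    N≤2^E N-smooth = begin
      N                                    ≤⟨ smooth-bound (m^n>0 2 (i + i + 10)) √B≤R y N (binomial>0 m m) N-smooth ⟩
      B ^ (y ⊓ R) * primorial y            ≤⟨ *-mono-≤ (^-monoʳ-≤ B {{m^n≢0 2 (i + i + 10)}} (m⊓n≤n y R)) (primorial≤8^ y) ⟩
      B ^ R * 2 ^ (3 * y)                  ≡⟨ cong (_* 2 ^ (3 * y)) (^-*-assoc 2 (i + i + 10) R) ⟩
      2 ^ ((i + i + 10) * R) * 2 ^ (3 * y) ≡⟨ ^-distribˡ-+-* 2 ((i + i + 10) * R) (3 * y) ⟨
      2 ^ E                                ∎
      where open ≤-Reasoning
    search : Dec (∃ λ q → q < suc B × (Prime q × y < q)) → ∃ λ p → Prime p × y < p × p ≤ B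
    search (yes (p , p<1+B , p-prime , y<p)) = p , p-prime , y<p , s≤s⁻¹ p<1+B
    search (no ∄p) = ⊥-elim (<⇒≱ 2^E<N (N≤2^E N-smooth))
      where
      N-smooth : PowerSmooth y B N
      N-smooth .PowerSmooth.prime≤ {q} q-prime q∣N with y <? q
      ... | yes y<q = ⊥-elim (∄p (q , s≤s (subst (q ≤_) (sym B≡m+m) (prime∣binomial⇒≤ m m q-prime q∣N)) , q-prime , y<q))
      ... | no  y≮q = ≮⇒≥ y≮q
      N-smooth .PowerSmooth.primePower≤ f q-prime qᶠ∣N =
        subst (_ ≤_) (sym B≡m+m) (Valuation.p^∣binomial⇒≤ q-prime m (m^n>0 2 (i + i + 9)) f qᶠ∣N)

  2^[i+i+k]-suc : ∀ i k → 2 ^ (suc i + suc i + k) ≡ 4 * 2 ^ (i + i + k)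
  2^[i+i+k]-suc i k = trans (cong (2 ^_) (cong (_+ k) (cong suc (+-suc i i)))) (quadruple (2 ^ (i + i + k)))
    where
    quadruple : ∀ x → 2 * (2 * x) ≡ 4 * x
    quadruple = solve-∀

  bracket : ∀ n → 2 ^ 10 ≤ n → ∃ λ i → 2 ^ (i + i + 10) ≤ n × n < 2 ^ (i + i + 12)
  bracket = <-rec _ step
    where
    step : ∀ n → (∀ {m} → m < n → 2 ^ 10 ≤ m → ∃ λ i → 2 ^ (i + i + 10) ≤ m × m < 2 ^ (i + i + 12)) →
           2 ^ 10 ≤ n → ∃ λ i → 2 ^ (i + i + 10) ≤ n × n < 2 ^ (i + i + 12)
    step n rec 2^10≤n with n <? 2 ^ 12
    ... | yes n<2^12 = 0 , 2^10≤n , n<2^12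
    ... | no  n≮2^12 with rec (m/n<m n 4 {{>-nonZero (≤-trans z<s 2^10≤n)}} (s≤s (s≤s z≤n))) (/-monoˡ-≤ 4 (≮⇒≥ n≮2^12))
    ...   | i , lo , hi = suc i , lo′ , hi′
      where
      open ≤-Reasoning
      lo′ : 2 ^ (suc i + suc i + 10) ≤ n
      lo′ = begin
        2 ^ (suc i + suc i + 10) ≡⟨ 2^[i+i+k]-suc i 10 ⟩
        4 * 2 ^ (i + i + 10)     ≤⟨ *-monoʳ-≤ 4 lo ⟩
        4 * (n / 4)              ≡⟨ *-comm 4 (n / 4) ⟩
        n / 4 * 4                ≤⟨ m/n*n≤m n 4 ⟩
        n                        ∎
      hi′ : n < 2 ^ (suc i + suc i + 12)
      hi′ = begin-strict
        n                        ≡⟨ m≡m%n+[m/n]*n n 4 ⟩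
        n % 4 + n / 4 * 4        <⟨ +-monoˡ-< (n / 4 * 4) (m%n<n n 4) ⟩
        4 + n / 4 * 4            ≡⟨ *-comm (suc (n / 4)) 4 ⟩
        4 * suc (n / 4)          ≤⟨ *-monoʳ-≤ 4 hi ⟩
        4 * 2 ^ (i + i + 12)     ≡⟨ 2^[i+i+k]-suc i 12 ⟨
        2 ^ (suc i + suc i + 12) ∎

  prime-in-range : ∀ n → 2 ^ 10 ≤ n → ∃ λ p → ∃ λ y → Prime p × y < p × p ≤ n × n < 128 * y
  prime-in-range n 2^10≤n =
    let (i , 2^[2i+10]≤n , n<2^[2i+12]) = bracket n 2^10≤n
        (p , p-prime , y<p , p≤2^[2i+10]) = bertrand-weak i
    in p , 2 ^ (i + i + 5) , p-prime , y<p , ≤-trans p≤2^[2i+10] 2^[2i+10]≤n ,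
       subst (n <_) (trans (cong (2 ^_) (sym (+-assoc (i + i) 5 7)))
                           (trans (^-distribˡ-+-* 2 (i + i + 5) 7) (*-comm (2 ^ (i + i + 5)) 128))) n<2^[2i+12]


module Polynomial where

  open import Data.Nat.Base as ℕ using (ℕ; zero; suc; z≤n; s≤s)
  import Data.Nat.Properties as ℕ
  open import Data.Integer.Base using (ℤ; +_; 0ℤ; 1ℤ; _+_; _*_; _-_; -_; _^_)
  open import Data.Integer.Properties
  open import Data.Integer.Tactic.RingSolver using (solve-∀)
  open import Algebra.Properties.Semiring.Sum +-*-semiring using (sum; sum-syntax; sum-cong-≗; *-distribˡ-sum)
  open import Data.Fin.Base using (Fin; zero; suc; toℕ)
  open import Data.Vec.Base using (Vec; []; _∷_)
  open import Data.Vec.Relation.Unary.All using (All; []; _∷_)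
  open import Relation.Nullary using (yes; no)
  open import Function.Base using (_∘_)
  open import Data.Nat.Primality using (Prime)
  open import Relation.Binary.PropositionalEquality

  -- coefficients are listed from the leading one down
  eval : ∀ {n} → Vec ℤ n → ℤ → ℤ
  eval []                 t = 0ℤ
  eval {suc n} (a ∷ as) t = a * t ^ n + eval as t

  -- synthetic division by t - r
  quot : ∀ {n} → ℤ → Vec ℤ (suc n) → Vec ℤ n
  quot {zero}  r (a ∷ [])     = []
  quot {suc n} r (a ∷ b ∷ bs) = a ∷ quot r (b + r * a ∷ bs)

  eval-absorbLeading : ∀ {n} r a b (bs : Vec ℤ n) → eval (b + r * a ∷ bs) r ≡ eval (a ∷ b ∷ bs) r
  eval-absorbLeading {n} r a b bs = regroup a b r (r ^ n) (eval bs r)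
    where
    regroup : ∀ a b r R E → (b + r * a) * R + E ≡ a * (r * R) + (b * R + E)
    regroup = solve-∀

  eval-quot : ∀ {n} r t (P : Vec ℤ (suc n)) → eval P t ≡ (t - r) * eval (quot r P) t + eval P r
  eval-quot {zero}  r t (a ∷ [])     = constant a t r
    where
    constant : ∀ a t r → a * 1ℤ + 0ℤ ≡ (t - r) * 0ℤ + (a * 1ℤ + 0ℤ)
    constant = solve-∀
  eval-quot {suc n} r t (a ∷ b ∷ bs) = begin
    a * (t * T) + (b * T + eval bs t)                   ≡⟨ regroup a b r t T (eval bs t) ⟩
    (t - r) * (a * T) + eval P′ t                      ≡⟨ cong (_+_ ((t - r) * (a * T))) (eval-quot r t P′) ⟩
    (t - r) * (a * T) + ((t - r) * W + eval P′ r)      ≡⟨ collect (t - r) (a * T) W (eval P′ r) ⟩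
    (t - r) * (a * T + W) + eval P′ r                  ≡⟨ cong (_+_ ((t - r) * (a * T + W))) (eval-absorbLeading r a b bs) ⟩
    (t - r) * (a * T + W) + eval (a ∷ b ∷ bs) r        ∎
    where
    open ≡-Reasoning
    T  = t ^ n
    P′ = b + r * a ∷ bs
    W  = eval (quot r P′) t
    regroup : ∀ a b r t T E → a * (t * T) + (b * T + E) ≡ (t - r) * (a * T) + ((b + r * a) * T + E)
    regroup = solve-∀
    collect : ∀ x y w e → x * y + (x * w + e) ≡ x * (y + w) + e
    collect = solve-∀

  module Roots {p} (p-prime : Prime p) where

    open import Data.Nat.Primality using (euclidsLemma)
    open import Data.Nat.Divisibility using () renaming (_∣_ to _∣ℕ_)
    import Data.Integer.Base as ℤ
    open import Data.Integer.Divisibility.Signed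
    open import Data.Sum.Base using (_⊎_; inj₁; inj₂; [_,_]′)
    open import Function.Base using (id)
    open import Relation.Nullary using (¬_; contradiction)
    import Data.Fin.Properties as Fin

    ∣-*-prime : ∀ a b → + p ∣ a * b → + p ∣ a ⊎ + p ∣ b
    ∣-*-prime a b p∣ab with euclidsLemma ℤ.∣ a ∣ ℤ.∣ b ∣ p-prime (subst (p ∣ℕ_) (abs-* a b) (∣⇒∣ᵤ p∣ab))
    ... | inj₁ p∣a = inj₁ (∣ᵤ⇒∣ p∣a)
    ... | inj₂ p∣b = inj₂ (∣ᵤ⇒∣ p∣b)

    Distinct : ∀ {m} → (Fin m → ℤ) → Set
    Distinct rs = ∀ i j → i ≢ j → ¬ + p ∣ rs i - rs j

    Distinct-tail : ∀ {m} (rs : Fin (suc m) → ℤ) → Distinct rs → Distinct (rs ∘ suc)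
    Distinct-tail rs distinct i j i≢j = distinct (suc i) (suc j) (i≢j ∘ Fin.suc-injective)

    quot-root : ∀ {n} (P : Vec ℤ (suc n)) r t → ¬ + p ∣ t - r →
                + p ∣ eval P t → + p ∣ eval P r → + p ∣ eval (quot r P) t
    quot-root P r t p∤t-r p∣Pt p∣Pr =
      [ (λ p∣t-r → contradiction p∣t-r p∤t-r) , id ]′
        (∣-*-prime (t - r) _ (∣m+n∣n⇒∣m (subst (+ p ∣_) (eval-quot r t P) p∣Pt) p∣Pr))

    coefficients-from-quot : ∀ {n} r (P : Vec ℤ (suc n)) → All (+ p ∣_) (quot r P) → + p ∣ eval P r →
                             All (+ p ∣_) P
    coefficients-from-quot {zero}  r (a ∷ [])     [] p∣a = subst (+ p ∣_) (trans (+-identityʳ _) (*-identityʳ a)) p∣a ∷ []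
    coefficients-from-quot {suc n} r (a ∷ b ∷ bs) (p∣a ∷ p∣Q′) p∣Pr
      with coefficients-from-quot r (b + r * a ∷ bs) p∣Q′ (subst (+ p ∣_) (sym (eval-absorbLeading r a b bs)) p∣Pr)
    ... | p∣b+ra ∷ p∣bs = p∣a ∷ ∣m+n∣n⇒∣m p∣b+ra (∣n⇒∣m*n r p∣a) ∷ p∣bs

    roots⇒coefficients : ∀ n (P : Vec ℤ (suc n)) (rs : Fin (suc n) → ℤ) → Distinct rs →
                         (∀ i → + p ∣ eval P (rs i)) → All (+ p ∣_) P
    roots⇒coefficients zero    (a ∷ []) rs _ roots =
      subst (+ p ∣_) (trans (+-identityʳ _) (*-identityʳ a)) (roots zero) ∷ []
    roots⇒coefficients (suc n) P rs distinct roots =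
      coefficients-from-quot (rs zero) P
        (roots⇒coefficients n (quot (rs zero) P) (rs ∘ suc) (Distinct-tail rs distinct)
          λ i → quot-root P (rs zero) (rs (suc i)) (distinct (suc i) zero λ ()) (roots (suc i)) (roots zero))
        (roots zero)

    -- Vieta's formula for the sum of the roots
    roots⇒second-coefficient : ∀ n L s (bs : Vec ℤ n) (rs : Fin (suc n) → ℤ) → Distinct rs →
                               (∀ i → + p ∣ eval (L ∷ s ∷ bs) (rs i)) → + p ∣ s + L * sum rs
    roots⇒second-coefficient zero    L s []       rs _ roots = subst (+ p ∣_) (linear L s (rs zero)) (roots zero)
      where
      linear : ∀ L s r → L * (r * 1ℤ) + (s * 1ℤ + 0ℤ) ≡ s + L * (r + 0ℤ)
      linear = solve-∀
    roots⇒second-coefficient (suc n) L s (b ∷ bs) rs distinct roots =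
      subst (+ p ∣_) (regroup L s (rs zero) (sum (rs ∘ suc)))
        (roots⇒second-coefficient n L (s + r₀ * L) (quot r₀ (b + r₀ * (s + r₀ * L) ∷ bs)) (rs ∘ suc)
          (Distinct-tail rs distinct)
          λ i → quot-root (L ∷ s ∷ b ∷ bs) r₀ (rs (suc i)) (distinct (suc i) zero λ ()) (roots (suc i)) (roots zero))
      where
      r₀ = rs zero
      regroup : ∀ L s r S → s + r * L + L * S ≡ s + L * (r + S)
      regroup = solve-∀

  fromCoeffs : ∀ n → (ℕ → ℤ) → Vec ℤ (suc n)
  fromCoeffs zero    κ = κ 0 ∷ []
  fromCoeffs (suc n) κ = κ (suc n) ∷ fromCoeffs n κ

  eval-fromCoeffs-suc : ∀ n κ t → eval (fromCoeffs (suc n) κ) t ≡ κ 0 + t * eval (fromCoeffs n (κ ∘ suc)) t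
  eval-fromCoeffs-suc zero    κ t = linear (κ 1) (κ 0) t
    where
    linear : ∀ a b t → a * (t * 1ℤ) + (b * 1ℤ + 0ℤ) ≡ b + t * (a * 1ℤ + 0ℤ)
    linear = solve-∀
  eval-fromCoeffs-suc (suc n) κ t = begin
    a * (t * t ^ suc n) + eval (fromCoeffs (suc n) κ) t ≡⟨ cong (_+_ (a * (t * t ^ suc n))) (eval-fromCoeffs-suc n κ t) ⟩
    a * (t * t ^ suc n) + (κ 0 + t * E)                  ≡⟨ regroup a t (t ^ suc n) (κ 0) E ⟩
    κ 0 + t * (a * t ^ suc n + E)                        ∎
    where
    open ≡-Reasoning
    a = κ (suc (suc n))
    E = eval (fromCoeffs n (κ ∘ suc)) t
    regroup : ∀ a t T b E → a * (t * T) + (b + t * E) ≡ b + t * (a * T + E)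
    regroup = solve-∀

  eval-fromCoeffs-0 : ∀ n t → eval (fromCoeffs n (λ _ → 0ℤ)) t ≡ 0ℤ
  eval-fromCoeffs-0 zero    t = refl
  eval-fromCoeffs-0 (suc n) t = trans (cong (_+_ (0ℤ * t ^ suc n)) (eval-fromCoeffs-0 n t)) (+-identityʳ (0ℤ * t ^ suc n))

  eval-fromCoeffs-linear : ∀ n M κ μ t →
    eval (fromCoeffs n (λ e → M * κ e + μ e)) t ≡ M * eval (fromCoeffs n κ) t + eval (fromCoeffs n μ) t
  eval-fromCoeffs-linear zero    M κ μ t = distribute M (κ 0) (μ 0) 1ℤ
    where
    distribute : ∀ M a b T → (M * a + b) * T + 0ℤ ≡ M * (a * T + 0ℤ) + (b * T + 0ℤ)
    distribute = solve-∀
  eval-fromCoeffs-linear (suc n) M κ μ t = begin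
    (M * κ (suc n) + μ (suc n)) * T + eval (fromCoeffs n (λ e → M * κ e + μ e)) t
      ≡⟨ cong (_+_ ((M * κ (suc n) + μ (suc n)) * T)) (eval-fromCoeffs-linear n M κ μ t) ⟩
    (M * κ (suc n) + μ (suc n)) * T + (M * eval (fromCoeffs n κ) t + eval (fromCoeffs n μ) t)
      ≡⟨ distribute M (κ (suc n)) (μ (suc n)) T _ _ ⟩
    M * (κ (suc n) * T + eval (fromCoeffs n κ) t) + (μ (suc n) * T + eval (fromCoeffs n μ) t) ∎
    where
    open ≡-Reasoning
    T = t ^ suc n
    distribute : ∀ M a b T E F → (M * a + b) * T + (M * E + F) ≡ M * (a * T + E) + (b * T + F)
    distribute = solve-∀

  padZero : ∀ {m} → (Fin m → ℤ) → ℕ → ℤ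
  padZero {zero}  f e       = 0ℤ
  padZero {suc m} f zero    = f zero
  padZero {suc m} f (suc e) = padZero (f ∘ suc) e

  padZero-≥ : ∀ {m} (f : Fin m → ℤ) {e} → m ℕ.≤ e → padZero f e ≡ 0ℤ
  padZero-≥ {zero}  f _         = refl
  padZero-≥ {suc m} f (s≤s m≤e) = padZero-≥ (f ∘ suc) m≤e

  padZero-toℕ : ∀ {m} (f : Fin m → ℤ) k → padZero f (toℕ k) ≡ f k
  padZero-toℕ f zero    = refl
  padZero-toℕ f (suc k) = padZero-toℕ (f ∘ suc) k

  All-fromCoeffs : ∀ {P : ℤ → Set} n κ → All P (fromCoeffs n κ) → ∀ {e} → e ℕ.≤ n → P (κ e)
  All-fromCoeffs zero    κ (Pκ₀ ∷ []) z≤n = Pκ₀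
  All-fromCoeffs (suc n) κ (Pκₙ ∷ Pκ) {e} e≤1+n with e ℕ.≟ suc n
  ... | yes refl   = Pκₙ
  ... | no  e≢1+n  = All-fromCoeffs n κ Pκ (ℕ.s≤s⁻¹ (ℕ.≤∧≢⇒< e≤1+n e≢1+n))

  eval-fromCoeffs-padZero : ∀ {m} n (f : Fin m → ℤ) t → m ℕ.≤ suc n →
    eval (fromCoeffs n (padZero f)) t ≡ ∑[ k < m ] (f k * t ^ toℕ k)
  eval-fromCoeffs-padZero {zero}  n       f t _ = eval-fromCoeffs-0 n t
  eval-fromCoeffs-padZero {suc m} zero    f t (s≤s z≤n) = refl
  eval-fromCoeffs-padZero {suc m} (suc n) f t (s≤s m≤1+n) = begin
    eval (fromCoeffs (suc n) (padZero f)) t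
      ≡⟨ eval-fromCoeffs-suc n (padZero f) t ⟩
    f zero + t * eval (fromCoeffs n (padZero (f ∘ suc))) t
      ≡⟨ cong (λ x → f zero + t * x) (eval-fromCoeffs-padZero n (f ∘ suc) t m≤1+n) ⟩
    f zero + t * (∑[ k < m ] (f (suc k) * t ^ toℕ k))
      ≡⟨ cong₂ _+_ (sym (*-identityʳ (f zero))) (*-distribˡ-sum t (λ k → f (suc k) * t ^ toℕ k)) ⟩
    f zero * 1ℤ + ∑[ k < m ] (t * (f (suc k) * t ^ toℕ k))
      ≡⟨ cong (_+_ (f zero * 1ℤ)) (sum-cong-≗ λ k → shift t (f (suc k)) (t ^ toℕ k)) ⟩
    f zero * 1ℤ + ∑[ k < m ] (f (suc k) * (t * t ^ toℕ k))
      ∎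
    where
    open ≡-Reasoning
    shift : ∀ t a T → t * (a * T) ≡ a * (t * T)
    shift = solve-∀

  double : ℕ → ℕ
  double zero    = zero
  double (suc n) = suc (suc (double n))

  2*n≡double[n] : ∀ n → 2 ℕ.* n ≡ double n
  2*n≡double[n] zero    = refl
  2*n≡double[n] (suc n) = cong suc (trans (ℕ.+-suc n (n ℕ.+ 0)) (cong suc (2*n≡double[n] n)))

  n≤double[n] : ∀ n → n ℕ.≤ double n
  n≤double[n] zero    = z≤n
  n≤double[n] (suc n) = s≤s (ℕ.m≤n⇒m≤1+n (n≤double[n] n))

  isEven : ℕ → ℤ
  isEven zero          = 1ℤ
  isEven (suc zero)    = 0ℤ
  isEven (suc (suc e)) = isEven e

  isEven-double : ∀ n → isEven (double n) ≡ 1ℤ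
  isEven-double zero    = refl
  isEven-double (suc n) = isEven-double n

  isEven-suc-double : ∀ n → isEven (suc (double n)) ≡ 0ℤ
  isEven-suc-double zero    = refl
  isEven-suc-double (suc n) = isEven-suc-double n

  -- the coefficients of t ^ 2 + t ^ 4 + t ^ 6 + ⋯
  squareCoeff : ℕ → ℤ
  squareCoeff zero          = 0ℤ
  squareCoeff (suc zero)    = 0ℤ
  squareCoeff (suc (suc e)) = isEven e

  eval-fromCoeffs-suc² : ∀ n κ t →
    eval (fromCoeffs (suc (suc n)) κ) t ≡ κ 0 + t * (κ 1 + t * eval (fromCoeffs n (λ e → κ (suc (suc e)))) t)
  eval-fromCoeffs-suc² n κ t =
    trans (eval-fromCoeffs-suc (suc n) κ t) (cong (λ x → κ 0 + t * x) (eval-fromCoeffs-suc n (κ ∘ suc) t))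

  ∑-squares-shift : ∀ d t → t * t * (∑[ j < d ] (t ^ toℕ j * t ^ toℕ j)) ≡ ∑[ j < d ] (t ^ suc (toℕ j) * t ^ suc (toℕ j))
  ∑-squares-shift d t = begin
    t * t * (∑[ j < d ] (t ^ toℕ j * t ^ toℕ j))   ≡⟨ *-distribˡ-sum {d} (t * t) (λ j → t ^ toℕ j * t ^ toℕ j) ⟩
    ∑[ j < d ] (t * t * (t ^ toℕ j * t ^ toℕ j))   ≡⟨ sum-cong-≗ {d} (λ j → regroup t (t ^ toℕ j)) ⟩
    ∑[ j < d ] (t ^ suc (toℕ j) * t ^ suc (toℕ j)) ∎
    where
    open ≡-Reasoning
    regroup : ∀ t T → t * t * (T * T) ≡ t * T * (t * T)
    regroup = solve-∀

  eval-fromCoeffs-isEven : ∀ d t → eval (fromCoeffs (double d) isEven) t ≡ ∑[ j < suc d ] (t ^ toℕ j * t ^ toℕ j)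
  eval-fromCoeffs-isEven zero    t = refl
  eval-fromCoeffs-isEven (suc d) t = begin
    eval (fromCoeffs (double (suc d)) isEven) t ≡⟨ eval-fromCoeffs-suc² (double d) isEven t ⟩
    1ℤ + t * (0ℤ + t * E)                      ≡⟨ regroup t E ⟩
    1ℤ * 1ℤ + t * t * E                        ≡⟨ cong (λ x → 1ℤ * 1ℤ + t * t * x) (eval-fromCoeffs-isEven d t) ⟩
    1ℤ * 1ℤ + t * t * (∑[ j < suc d ] (t ^ toℕ j * t ^ toℕ j)) ≡⟨ cong (_+_ (1ℤ * 1ℤ)) (∑-squares-shift (suc d) t) ⟩
    1ℤ * 1ℤ + ∑[ j < suc d ] (t ^ suc (toℕ j) * t ^ suc (toℕ j)) ∎
    where
    open ≡-Reasoning
    E = eval (fromCoeffs (double d) isEven) t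
    regroup : ∀ t E → 1ℤ + t * (0ℤ + t * E) ≡ 1ℤ * 1ℤ + t * t * E
    regroup = solve-∀

  eval-fromCoeffs-squareCoeff : ∀ d t →
    eval (fromCoeffs (double d) squareCoeff) t ≡ ∑[ j < d ] (t ^ suc (toℕ j) * t ^ suc (toℕ j))
  eval-fromCoeffs-squareCoeff zero    t = refl
  eval-fromCoeffs-squareCoeff (suc d) t = begin
    eval (fromCoeffs (double (suc d)) squareCoeff) t ≡⟨ eval-fromCoeffs-suc² (double d) squareCoeff t ⟩
    0ℤ + t * (0ℤ + t * E)                           ≡⟨ regroup t E ⟩
    t * t * E                                       ≡⟨ cong (t * t *_) (eval-fromCoeffs-isEven d t) ⟩
    t * t * (∑[ j < suc d ] (t ^ toℕ j * t ^ toℕ j)) ≡⟨ ∑-squares-shift (suc d) t ⟩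
    ∑[ j < suc d ] (t ^ suc (toℕ j) * t ^ suc (toℕ j)) ∎
    where
    open ≡-Reasoning
    E = eval (fromCoeffs (double d) isEven) t
    regroup : ∀ t E → 0ℤ + t * (0ℤ + t * E) ≡ t * t * E
    regroup = solve-∀

module Rationals where

  open import Data.Nat.Base as ℕ using (ℕ; zero; suc; z<s)
  import Data.Nat.Properties as ℕ
  open import Data.Nat.Coprimality using (1-coprimeTo)
  import Data.Nat.Coprimality as Coprimality
  open import Data.Integer.Base as ℤ using (ℤ; +_; 1ℤ)
  import Data.Integer.Properties as ℤ
  open import Data.Integer.Tactic.RingSolver using (solve-∀)
  open import Algebra.Properties.Semiring.Sum ℤ.+-*-semiring using (sum)
  open import Data.Rational.Base
  open import Data.Rational.Properties
  import Data.Rational.Unnormalised.Base as ℚᵘ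
  import Data.Rational.Unnormalised.Properties as ℚᵘ
  open import Data.Rational.Solver using (module +-*-Solver)
  open import Data.Fin.Base using (Fin; zero; suc)
  open import Data.Product.Base using (Σ; _×_; _,_)
  open import Function.Base using (_∘_)
  open import Relation.Binary.PropositionalEquality
  open import Defs using (sumℚ)

  -- ι (+ k) is definitionally toℚ k
  ι : ℤ → ℚ
  ι z = z / 1

  ι≡mkℚ : ∀ z → ι z ≡ mkℚ z 0 (Coprimality.sym (1-coprimeTo ℤ.∣ z ∣))
  ι≡mkℚ z = ↥p/↧p≡p (mkℚ z 0 (Coprimality.sym (1-coprimeTo ℤ.∣ z ∣)))

  ι-* : ∀ a b → ι (a ℤ.* b) ≡ ι a * ι b
  ι-* a b rewrite ι≡mkℚ a | ι≡mkℚ b = refl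

  ι-+ : ∀ a b → ι (a ℤ.+ b) ≡ ι a + ι b
  ι-+ a b rewrite ι≡mkℚ a | ι≡mkℚ b | ℤ.*-identityʳ a | ℤ.*-identityʳ b = refl

  ι-injective : ∀ {a b} → ι a ≡ ι b → a ≡ b
  ι-injective {a} {b} eq = trans (cong ↥_ (sym (ι≡mkℚ a))) (trans (cong ↥_ eq) (cong ↥_ (ι≡mkℚ b)))

  ι-sum : ∀ {m} (u : Fin m → ℤ) → ι (sum u) ≡ sumℚ m (ι ∘ u)
  ι-sum {zero}  u = refl
  ι-sum {suc m} u = trans (ι-+ (u zero) (sum (u ∘ suc))) (cong (_+_ (ι (u zero))) (ι-sum (u ∘ suc)))

  ι[↧]*q≡ι[↥] : ∀ q → ι (+ ↧ₙ q) * q ≡ ι (↥ q)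
  ι[↧]*q≡ι[↥] q@(mkℚ n d _) = toℚᵘ-injective (ℚᵘ.≃-trans (toℚᵘ-homo-* (ι (+ suc d)) q)
    (cross (ι (+ suc d)) (ι n) (ι≡mkℚ (+ suc d)) (ι≡mkℚ n)))
    where
    cross : ∀ x y → x ≡ mkℚ (+ suc d) 0 (Coprimality.sym (1-coprimeTo (suc d))) →
            y ≡ mkℚ n 0 (Coprimality.sym (1-coprimeTo ℤ.∣ n ∣)) → toℚᵘ x ℚᵘ.* toℚᵘ q ℚᵘ.≃ toℚᵘ y
    cross _ _ refl refl = ℚᵘ.*≡* (swap (+ suc d) n)
      where
      swap : ∀ a b → a ℤ.* b ℤ.* 1ℤ ≡ b ℤ.* (1ℤ ℤ.* a)
      swap = solve-∀

  ι-+-* : ∀ m n → ι (+ (m ℕ.* n)) ≡ ι (+ m) * ι (+ n)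
  ι-+-* m n = trans (cong ι (ℤ.pos-* m n)) (ι-* (+ m) (+ n))

  clear-denominators : ∀ {m} (v : Fin m → ℚ) →
                       Σ ℕ λ D → Σ (Fin m → ℤ) λ C → 0 ℕ.< D × (∀ k → ι (C k) ≡ ι (+ D) * v k)
  clear-denominators {zero}  v = 1 , (λ ()) , z<s , λ ()
  clear-denominators {suc m} v with clear-denominators (v ∘ suc)
  ... | D , C , D>0 , C≡Dv = d₀ ℕ.* D , C′ , ℕ.*-mono-< {0} {d₀} {0} {D} z<s D>0 , C′≡Dv
    where
    open ≡-Reasoning
    open +-*-Solver
    d₀ = ↧ₙ (v zero)
    C′ : Fin (suc m) → ℤ
    C′ zero    = ↥ (v zero) ℤ.* + D
    C′ (suc k) = + d₀ ℤ.* C k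
    C′≡Dv : ∀ k → ι (C′ k) ≡ ι (+ (d₀ ℕ.* D)) * v k
    C′≡Dv zero = begin
      ι (↥ (v zero) ℤ.* + D)            ≡⟨ ι-* (↥ (v zero)) (+ D) ⟩
      ι (↥ (v zero)) * ι (+ D)          ≡⟨ cong (_* ι (+ D)) (ι[↧]*q≡ι[↥] (v zero)) ⟨
      ι (+ d₀) * v zero * ι (+ D)       ≡⟨ solve 3 (λ x y c → x :* c :* y := x :* y :* c) refl (ι (+ d₀)) (ι (+ D)) (v zero) ⟩
      ι (+ d₀) * ι (+ D) * v zero       ≡⟨ cong (_* v zero) (ι-+-* d₀ D) ⟨
      ι (+ (d₀ ℕ.* D)) * v zero         ∎
    C′≡Dv (suc k) = begin
      ι (+ d₀ ℤ.* C k)                  ≡⟨ ι-* (+ d₀) (C k) ⟩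
      ι (+ d₀) * ι (C k)                ≡⟨ cong (ι (+ d₀) *_) (C≡Dv k) ⟩
      ι (+ d₀) * (ι (+ D) * v (suc k))  ≡⟨ *-assoc (ι (+ d₀)) (ι (+ D)) (v (suc k)) ⟨
      ι (+ d₀) * ι (+ D) * v (suc k)    ≡⟨ cong (_* v (suc k)) (ι-+-* d₀ D) ⟨
      ι (+ (d₀ ℕ.* D)) * v (suc k)      ∎

  ι[n]*q≡0⇒q≡0 : ∀ n q → 0 ℕ.< n → ι (+ n) * q ≡ 0ℚ → q ≡ 0ℚ
  ι[n]*q≡0⇒q≡0 n@(suc _) q _ nq≡0 = begin
    q                  ≡⟨ *-identityˡ q ⟨
    1ℚ * q             ≡⟨ cong (_* q) (*-inverseˡ x) ⟨
    1/ x * x * q       ≡⟨ *-assoc (1/ x) x q ⟩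
    1/ x * (x * q)     ≡⟨ cong (λ y → 1/ x * (y * q)) (ι≡mkℚ (+ n)) ⟨
    1/ x * (ι (+ n) * q) ≡⟨ cong (1/ x *_) nq≡0 ⟩
    1/ x * 0ℚ          ≡⟨ *-zeroʳ (1/ x) ⟩
    0ℚ                 ∎
    where
    open ≡-Reasoning
    x = mkℚ (+ n) 0 (Coprimality.sym (1-coprimeTo n))

  ι-mono-≤ : ∀ {a b} → a ℤ.≤ b → ι a ≤ ι b
  ι-mono-≤ {a} {b} a≤b rewrite ι≡mkℚ a | ι≡mkℚ b = *≤* (subst₂ ℤ._≤_ (sym (ℤ.*-identityʳ a)) (sym (ℤ.*-identityʳ b)) a≤b)

  sumℚ-cong : ∀ m {f g : Fin m → ℚ} → (∀ k → f k ≡ g k) → sumℚ m f ≡ sumℚ m g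
  sumℚ-cong zero    f≗g = refl
  sumℚ-cong (suc m) f≗g = cong₂ _+_ (f≗g zero) (sumℚ-cong m (f≗g ∘ suc))

  *-distribˡ-sumℚ : ∀ m c (f : Fin m → ℚ) → c * sumℚ m f ≡ sumℚ m (λ k → c * f k)
  *-distribˡ-sumℚ zero    c f = *-zeroʳ c
  *-distribˡ-sumℚ (suc m) c f = trans (*-distribˡ-+ c (f zero) _) (cong (_+_ (c * f zero)) (*-distribˡ-sumℚ m c (f ∘ suc)))


module LinearRelations where

  open import Data.Nat.Base as ℕ using (ℕ; z<s)
  import Data.Nat.Properties as ℕ
  open import Data.Integer.Base as ℤ using (ℤ; +_; 0ℤ)
  import Data.Integer.Properties as ℤ
  open import Data.Integer.Tactic.RingSolver using (solve-∀)
  open import Algebra.Properties.Semiring.Sum ℤ.+-*-semiring using (sum-syntax)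
  open import Data.Rational.Base using (ℚ; 0ℚ; _*_)
  open import Data.Rational.Properties using (*-assoc; *-zeroʳ)
  open import Data.Fin.Base using (Fin)
  open import Data.Product.Base using (_,_)
  open import Relation.Binary.PropositionalEquality
  open import Defs using (sumℚ)
  open Rationals

  IntRelation : ∀ {n m} → (Fin n → Fin m → ℤ) → (Fin m → ℤ) → Set
  IntRelation {m = m} F C = ∀ i → ∑[ k < m ] (C k ℤ.* F i k) ≡ 0ℤ

  RatRelation : ∀ {n m} → (Fin n → Fin m → ℤ) → (Fin m → ℚ) → Set
  RatRelation {m = m} F v = ∀ i → sumℚ m (λ k → v k * ι (F i k)) ≡ 0ℚ

  ratRelation⇒intRelation : ∀ {n m} (F : Fin n → Fin m → ℤ) {v D C} → (∀ k → ι (C k) ≡ ι (+ D) * v k) →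
                            RatRelation F v → IntRelation F C
  ratRelation⇒intRelation {m = m} F {v} {D} {C} C≡Dv rel i = ι-injective (begin
    ι (∑[ k < m ] (C k ℤ.* F i k))          ≡⟨ ι-sum (λ k → C k ℤ.* F i k) ⟩
    sumℚ m (λ k → ι (C k ℤ.* F i k))        ≡⟨ sumℚ-cong m (λ k → trans (ι-* (C k) (F i k)) (cong (_* ι (F i k)) (C≡Dv k))) ⟩
    sumℚ m (λ k → ι (+ D) * v k * ι (F i k)) ≡⟨ sumℚ-cong m (λ k → *-assoc (ι (+ D)) (v k) (ι (F i k))) ⟩
    sumℚ m (λ k → ι (+ D) * (v k * ι (F i k))) ≡⟨ *-distribˡ-sumℚ m (ι (+ D)) _ ⟨
    ι (+ D) * sumℚ m (λ k → v k * ι (F i k)) ≡⟨ cong (ι (+ D) *_) (rel i) ⟩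
    ι (+ D) * 0ℚ                            ≡⟨ *-zeroʳ (ι (+ D)) ⟩
    ι 0ℤ                                    ∎)
    where open ≡-Reasoning

  module _ {p} (1<p : 1 ℕ.< p) where

    open import Data.Integer.Divisibility.Signed using (_∣_; module _∣_)
    open import Algebra.Properties.Semiring.Sum ℤ.+-*-semiring using (sum-cong-≗; *-distribˡ-sum)
    open import Data.Nat.Induction using (<-rec)
    open import Data.Sum.Base using (inj₁; inj₂)
    open import Data.Empty using (⊥-elim)
    open import Relation.Nullary using (yes; no)

    descent : ∀ {m} (R : (Fin m → ℤ) → Set) → (∀ {C} → R C → ∀ k → + p ∣ C k) →
              (∀ {C q} → (∀ k → C k ≡ q k ℤ.* + p) → R C → R q) → ∀ {C} → R C → ∀ k → C k ≡ 0ℤ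
    descent {m} R divisible divide {C} rC k = <-rec P step ℤ.∣ C k ∣ C refl rC
      where
      P : ℕ → Set
      P n = ∀ C → ℤ.∣ C k ∣ ≡ n → R C → C k ≡ 0ℤ
      step : ∀ n → (∀ {n′} → n′ ℕ.< n → P n′) → P n
      step _ rec C refl rC with ℤ.∣ C k ∣ ℕ.≟ 0
      ... | yes ∣Cₖ∣≡0 = ℤ.∣i∣≡0⇒i≡0 ∣Cₖ∣≡0
      ... | no  ∣Cₖ∣≢0 = trans (C≡qp k) (cong (ℤ._* + p) (rec ∣qₖ∣<∣Cₖ∣ q refl (divide C≡qp rC)))
        where
        q : Fin m → ℤ
        q l = _∣_.quotient (divisible rC l)
        C≡qp : ∀ l → C l ≡ q l ℤ.* + p
        C≡qp l = _∣_.equality (divisible rC l)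
        ∣Cₖ∣≡ : ℤ.∣ C k ∣ ≡ ℤ.∣ q k ∣ ℕ.* p
        ∣Cₖ∣≡ = trans (cong ℤ.∣_∣ (C≡qp k)) (ℤ.abs-* (q k) (+ p))
        ∣qₖ∣<∣Cₖ∣ : ℤ.∣ q k ∣ ℕ.< ℤ.∣ C k ∣
        ∣qₖ∣<∣Cₖ∣ = subst (ℤ.∣ q k ∣ ℕ.<_) (sym ∣Cₖ∣≡)
          (ℕ.m<m*n ℤ.∣ q k ∣ p {{ℕ.≢-nonZero λ ∣qₖ∣≡0 → ∣Cₖ∣≢0 (trans ∣Cₖ∣≡ (cong (ℕ._* p) ∣qₖ∣≡0))}} 1<p)

    intRelation-÷ : ∀ {n m} (F : Fin n → Fin m → ℤ) {C q} → (∀ k → C k ≡ q k ℤ.* + p) →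
                    IntRelation F C → IntRelation F q
    intRelation-÷ {m = m} F {C} {q} C≡qp rel i with ℤ.i*j≡0⇒i≡0∨j≡0 (+ p) p*∑≡0
      where
      open ≡-Reasoning
      p*∑≡0 : + p ℤ.* ∑[ k < m ] (q k ℤ.* F i k) ≡ 0ℤ
      p*∑≡0 = begin
        + p ℤ.* ∑[ k < m ] (q k ℤ.* F i k)     ≡⟨ *-distribˡ-sum (+ p) (λ k → q k ℤ.* F i k) ⟩
        ∑[ k < m ] (+ p ℤ.* (q k ℤ.* F i k))   ≡⟨ sum-cong-≗ {m} (λ k → trans (rotate (+ p) (q k) (F i k)) (cong (ℤ._* F i k) (sym (C≡qp k)))) ⟩
        ∑[ k < m ] (C k ℤ.* F i k)             ≡⟨ rel i ⟩
        0ℤ                                     ∎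
        where
        rotate : ∀ p q f → p ℤ.* (q ℤ.* f) ≡ q ℤ.* p ℤ.* f
        rotate = solve-∀
    ... | inj₁ p≡0 = ⊥-elim (ℕ.<⇒≢ (ℕ.<-trans z<s 1<p) (sym (ℤ.+-injective p≡0)))
    ... | inj₂ ∑≡0 = ∑≡0

    ratRelation-trivial : ∀ {n m} (F : Fin n → Fin m → ℤ) → (∀ {C} → IntRelation F C → ∀ k → + p ∣ C k) →
                          ∀ {v} → RatRelation F v → ∀ k → v k ≡ 0ℚ
    ratRelation-trivial F divisible {v} rel k with clear-denominators v
    ... | D , C , D>0 , C≡Dv = ι[n]*q≡0⇒q≡0 D (v k) D>0 (trans (sym (C≡Dv k)) (cong ι Cₖ≡0))
      where
      Cₖ≡0 : C k ≡ 0ℤ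
      Cₖ≡0 = descent (IntRelation F) divisible (λ {C′} {q} → intRelation-÷ F {C′} {q}) {C}
               (ratRelation⇒intRelation F {v} {D} {C} C≡Dv rel) k


module Congruence {p} (p-prime : Prime p) where

  open import Data.Nat.Base as ℕ using (ℕ; zero; suc; z≤n; _≤_; _<_; _%_; _/_)
  import Data.Nat.Properties as ℕ
  open import Data.Nat.DivMod using (m≡m%n+[m/n]*n)
  open import Data.Nat.Divisibility using (∣⇒≤) renaming (_∣_ to _∣ℕ_)
  open import Data.Nat.Primality using (prime⇒nonZero)
  open import Data.Integer.Base as ℤ using (ℤ; +_; 0ℤ; _+_; _*_; _-_; -_; _⊖_)
  import Data.Integer.Properties as ℤ
  open import Data.Integer.Divisibility.Signed
  open import Data.Integer.Tactic.RingSolver using (solve-∀)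
  open import Algebra.Properties.Semiring.Sum ℤ.+-*-semiring using (sum)
  import Algebra.Properties.Semiring.Sum ℕ.+-*-semiring as ℕ∑
  open import Data.Fin.Base using (Fin; zero; suc)
  open import Data.Product.Base using (_×_; proj₁; proj₂)
  open import Data.Sum.Base using (inj₁; inj₂)
  open import Data.Empty using (⊥-elim)
  open import Function.Base using (_∘_)
  open import Relation.Nullary using (¬_; yes; no)
  open import Relation.Binary.PropositionalEquality
  open Polynomial.Roots p-prime using (Distinct)

  instance
    p≢0 : ℕ.NonZero p
    p≢0 = prime⇒nonZero p-prime

  infix 4 _≈_
  record _≈_ (a b : ℤ) : Set where
    constructor congruent
    field
      p∣difference : + p ∣ a - b

  ≈-refl : ∀ {a} → a ≈ a
  ≈-refl {a} = congruent (subst (+ p ∣_) (sym (ℤ.+-inverseʳ a)) (divides 0ℤ refl))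

  ∣-resp-≈ : ∀ {a b} → + p ∣ a → a ≈ b → + p ∣ b
  ∣-resp-≈ {a} {b} p∣a (congruent p∣a-b) = subst (+ p ∣_) (cancel a b) (∣m∣n⇒∣m-n p∣a p∣a-b)
    where
    cancel : ∀ a b → a - (a - b) ≡ b
    cancel = solve-∀

  ≈-+ : ∀ {a b c d} → a ≈ b → c ≈ d → a + c ≈ b + d
  ≈-+ {a} {b} {c} {d} (congruent p∣a-b) (congruent p∣c-d) =
    congruent (subst (+ p ∣_) (regroup a b c d) (∣m∣n⇒∣m+n p∣a-b p∣c-d))
    where
    regroup : ∀ a b c d → (a - b) + (c - d) ≡ (a + c) - (b + d)
    regroup = solve-∀

  ≈-* : ∀ {a b c d} → a ≈ b → c ≈ d → a * c ≈ b * d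
  ≈-* {a} {b} {c} {d} (congruent p∣a-b) (congruent p∣c-d) =
    congruent (subst (+ p ∣_) (regroup a b c d) (∣m∣n⇒∣m+n (∣n⇒∣m*n a p∣c-d) (∣m⇒∣m*n d p∣a-b)))
    where
    regroup : ∀ a b c d → a * (c - d) + (a - b) * d ≡ a * c - b * d
    regroup = solve-∀

  ≈-sum : ∀ {m} {f g : Fin m → ℤ} → (∀ k → f k ≈ g k) → sum f ≈ sum g
  ≈-sum {zero}  f≈g = ≈-refl
  ≈-sum {suc m} f≈g = ≈-+ (f≈g zero) (≈-sum (f≈g ∘ suc))

  %-≈ : ∀ n → + (n % p) ≈ + n
  %-≈ n = congruent (divides (- + (n / p)) (begin
    + (n % p) - + n                       ≡⟨ cong (λ m → + (n % p) - + m) (m≡m%n+[m/n]*n n p) ⟩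
    + (n % p) - + (n % p ℕ.+ n / p ℕ.* p) ≡⟨ cong (λ m → + (n % p) - m) (trans (ℤ.pos-+ (n % p) _) (cong (_+_ (+ (n % p))) (ℤ.pos-* (n / p) p))) ⟩
    + (n % p) - (+ (n % p) + + (n / p) * + p) ≡⟨ cancel (+ (n % p)) (+ (n / p)) (+ p) ⟩
    - + (n / p) * + p                     ∎))
    where
    open ≡-Reasoning
    cancel : ∀ r q p → r - (r + q * p) ≡ - q * p
    cancel = solve-∀


  ∣a⊖b∣<p : ∀ {a b} → a < p → b < p → ℤ.∣ a ⊖ b ∣ < p
  ∣a⊖b∣<p {a} {b} a<p b<p with ℕ.≤-total a b
  ... | inj₁ a≤b = subst (_< p) (sym (ℤ.∣⊖∣-≤ a≤b)) (ℕ.≤-<-trans (ℕ.m∸n≤m b a) b<p)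
  ... | inj₂ b≤a = subst (_< p) (sym (trans (ℤ.∣m⊖n∣≡∣n⊖m∣ a b) (ℤ.∣⊖∣-≤ b≤a))) (ℕ.≤-<-trans (ℕ.m∸n≤m a b) a<p)

  p∣a-b⇒a≡b : ∀ {a b} → a < p → b < p → + p ∣ + a - + b → a ≡ b
  p∣a-b⇒a≡b {a} {b} a<p b<p p∣a-b with ℤ.∣ + a - + b ∣ ℕ.≟ 0
  ... | yes ∣a-b∣≡0 = ℤ.+-injective (ℤ.i-j≡0⇒i≡j _ _ (ℤ.∣i∣≡0⇒i≡0 ∣a-b∣≡0))
  ... | no  ∣a-b∣≢0 = ⊥-elim (ℕ.<⇒≱ (subst (_< p) (cong ℤ.∣_∣ (sym (ℤ.m-n≡m⊖n a b))) (∣a⊖b∣<p a<p b<p))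
                                       (∣⇒≤ {{ℕ.≢-nonZero ∣a-b∣≢0}} (∣⇒∣ᵤ p∣a-b)))

  distinct : ∀ {m} (τ : Fin m → ℕ) → (∀ {i j} → τ i ≡ τ j → i ≡ j) → (∀ i → τ i < p) → Distinct (+_ ∘ τ)
  distinct τ τ-injective τ<p i j i≢j p∣τᵢ-τⱼ = i≢j (τ-injective (p∣a-b⇒a≡b (τ<p i) (τ<p j) p∣τᵢ-τⱼ))

  sum-pos : ∀ {m} (τ : Fin m → ℕ) → sum (+_ ∘ τ) ≡ + ℕ∑.sum τ
  sum-pos {zero}  τ = refl
  sum-pos {suc m} τ = trans (cong (ℤ._+_ (+ τ zero)) (sum-pos (τ ∘ suc))) (sym (ℤ.pos-+ (τ zero) _))

  sum≤ : ∀ {m T} (τ : Fin m → ℕ) → (∀ i → τ i ≤ T) → ℕ∑.sum τ ≤ m ℕ.* T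
  sum≤ {zero}  τ _     = z≤n
  sum≤ {suc m} τ τ≤T = ℕ.+-mono-≤ (τ≤T zero) (sum≤ (τ ∘ suc) (τ≤T ∘ suc))

  ∤sum : ∀ {m T} (τ : Fin (suc m) → ℕ) → (∀ i → 1 ≤ τ i × τ i ≤ T) → suc m ℕ.* T < p → ¬ + p ∣ sum (+_ ∘ τ)
  ∤sum τ τ∈[1,T] mT<p p∣∑τ = ℕ.<⇒≱ (ℕ.≤-<-trans (sum≤ τ (proj₂ ∘ τ∈[1,T])) mT<p)
    (∣⇒≤ {{ℕ.>-nonZero (ℕ.≤-trans (proj₁ (τ∈[1,T] zero)) (ℕ.m≤m+n _ _))}}
      (subst (p ∣ℕ_) (cong ℤ.∣_∣ (sum-pos τ)) (∣⇒∣ᵤ p∣∑τ)))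


module ModularRelations {p} (p-prime : Prime p) where

  open import Data.Nat.Base as ℕ using (ℕ; zero; suc; s≤s; _%_)
  import Data.Nat.Properties as ℕ
  open import Data.Integer.Base as ℤ using (ℤ; +_; 0ℤ; 1ℤ; _+_; _*_; _^_)
  import Data.Integer.Properties as ℤ
  open import Data.Integer.Divisibility.Signed
  open import Algebra.Properties.Semiring.Sum ℤ.+-*-semiring using (sum; sum-syntax)
  open import Data.Fin.Base using (Fin; zero; suc; toℕ; inject≤)
  import Data.Fin.Properties as Fin
  open import Data.Vec.Functional using (_∷_)
  open import Data.Sum.Base using ([_,_]′)
  open import Function.Base using (_∘_; id)
  open import Relation.Nullary using (¬_; contradiction)
  open import Relation.Binary.PropositionalEquality
  open import Defs using (Point)
  open Polynomial
  open Polynomial.Roots p-prime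
  open LinearRelations using (IntRelation)
  open Congruence p-prime

  momentPoint : ∀ {d} → ℕ → Point d
  momentPoint t j = t ℕ.^ suc (toℕ j) % p

  affineRow : ∀ {d} → ℕ → Fin (suc d) → ℤ
  affineRow t = 1ℤ ∷ (+_ ∘ momentPoint t)

  sphereRow : ∀ {d} → ℕ → Fin (suc (suc d)) → ℤ
  sphereRow {d} t = ∑[ j < d ] (+ momentPoint t j * + momentPoint t j) ∷ affineRow t

  pos-^ : ∀ t e → + (t ℕ.^ e) ≡ (+ t) ^ e
  pos-^ t zero    = refl
  pos-^ t (suc e) = trans (ℤ.pos-* t (t ℕ.^ e)) (cong (_*_ (+ t)) (pos-^ t e))

  affineRow-≈ : ∀ {d} t (k : Fin (suc d)) → affineRow t k ≈ (+ t) ^ toℕ k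
  affineRow-≈ t zero    = ≈-refl
  affineRow-≈ t (suc j) = subst (+ (t ℕ.^ suc (toℕ j) % p) ≈_) (pos-^ t (suc (toℕ j))) (%-≈ (t ℕ.^ suc (toℕ j)))

  affineRelation-divisible : ∀ {d} (τ : Fin (suc d) → ℕ) → Distinct (+_ ∘ τ) → ∀ C →
                             (∀ i → + p ∣ ∑[ k < suc d ] (C k * affineRow (τ i) k)) → ∀ k → + p ∣ C k
  affineRelation-divisible {d} τ distinct C p∣rows k =
    subst (+ p ∣_) (padZero-toℕ C k)
      (All-fromCoeffs d (padZero C) (roots⇒coefficients d (fromCoeffs d (padZero C)) (+_ ∘ τ) distinct roots)
        (Fin.toℕ≤pred[n] k))
    where
    roots : ∀ i → + p ∣ eval (fromCoeffs d (padZero C)) (+ τ i)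
    roots i = subst (+ p ∣_) (sym (eval-fromCoeffs-padZero d C (+ τ i) ℕ.≤-refl))
      (∣-resp-≈ (p∣rows i) (≈-sum {suc d} λ k → ≈-* (≈-refl {C k}) (affineRow-≈ (τ i) k)))

  -- the polynomial M (t² + t⁴ + ⋯ + t^2d) + Σₖ C′ₖ tᵏ, which vanishes modulo p on the moment curve
  sphereCoeff : ∀ {d} → ℤ → (Fin (suc d) → ℤ) → ℕ → ℤ
  sphereCoeff M C′ e = M * squareCoeff e + padZero C′ e

  sphereRow-root : ∀ {d} t (C : Fin (suc (suc d)) → ℤ) → ∑[ k < suc (suc d) ] (C k * sphereRow t k) ≡ 0ℤ →
                   + p ∣ eval (fromCoeffs (double d) (sphereCoeff (C zero) (C ∘ suc))) (+ t)
  sphereRow-root {d} t C rel = subst (+ p ∣_) (sym eval≡) (∣-resp-≈ (subst (+ p ∣_) (sym rel) (divides 0ℤ refl)) row≈)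
    where
    M = C zero
    x : Fin d → ℤ
    x j = + momentPoint t j
    row≈ : M * ∑[ j < d ] (x j * x j) + ∑[ k < suc d ] (C (suc k) * affineRow t k) ≈
           M * ∑[ j < d ] ((+ t) ^ suc (toℕ j) * (+ t) ^ suc (toℕ j)) + ∑[ k < suc d ] (C (suc k) * (+ t) ^ toℕ k)
    row≈ = ≈-+ (≈-* (≈-refl {M}) (≈-sum {d} λ j → ≈-* (affineRow-≈ t (suc j)) (affineRow-≈ t (suc j))))
               (≈-sum {suc d} λ k → ≈-* (≈-refl {C (suc k)}) (affineRow-≈ t k))
    eval≡ : eval (fromCoeffs (double d) (sphereCoeff M (C ∘ suc))) (+ t) ≡
            M * ∑[ j < d ] ((+ t) ^ suc (toℕ j) * (+ t) ^ suc (toℕ j)) + ∑[ k < suc d ] (C (suc k) * (+ t) ^ toℕ k)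
    eval≡ = trans (eval-fromCoeffs-linear (double d) M squareCoeff (padZero (C ∘ suc)) (+ t))
      (cong₂ (λ a b → M * a + b) (eval-fromCoeffs-squareCoeff d (+ t))
        (eval-fromCoeffs-padZero (double d) (C ∘ suc) (+ t) (s≤s (n≤double[n] d))))

  sphereRelation-divisible : ∀ {e} (τ : Fin (double (suc (suc e))) → ℕ) → Distinct (+_ ∘ τ) → ¬ + p ∣ sum (+_ ∘ τ) →
                             ∀ {C} → IntRelation (sphereRow ∘ τ) C → ∀ k → + p ∣ C k
  sphereRelation-divisible {e} τ distinct p∤∑τ {C} rel = p∣C
    where
    d = suc (suc e)
    M = C zero
    κ = sphereCoeff M (C ∘ suc)
    n = suc (double (suc e))
    -- the coefficients of t ^ 2d and t ^ (2d - 1); the latter vanishes because 2d - 1 > d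
    leading : κ (suc n) ≡ M
    leading = trans (cong₂ (λ a b → M * a + b) (isEven-double (suc e))
                      (padZero-≥ (C ∘ suc) (s≤s (s≤s (s≤s (ℕ.m≤n⇒m≤1+n (n≤double[n] e)))))))
                    (trans (ℤ.+-identityʳ (M * 1ℤ)) (ℤ.*-identityʳ M))
    second : κ n ≡ 0ℤ
    second = trans (cong₂ (λ a b → M * a + b) (isEven-suc-double e)
                     (padZero-≥ (C ∘ suc) (s≤s (s≤s (s≤s (n≤double[n] e))))))
                   (trans (ℤ.+-identityʳ (M * 0ℤ)) (ℤ.*-zeroʳ M))
    vieta : + p ∣ κ n + κ (suc n) * sum (+_ ∘ τ)
    vieta = roots⇒second-coefficient n (κ (suc n)) (κ n) (fromCoeffs (double (suc e)) κ) (+_ ∘ τ) distinct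
              λ i → sphereRow-root (τ i) C (rel i)
    p∣M∑τ : + p ∣ M * sum (+_ ∘ τ)
    p∣M∑τ = subst (+ p ∣_) top vieta
      where
      top : κ n + κ (suc n) * sum (+_ ∘ τ) ≡ M * sum (+_ ∘ τ)
      top = begin
        κ n + κ (suc n) * sum (+_ ∘ τ)   ≡⟨ cong₂ (λ s L → s + L * sum (+_ ∘ τ)) second leading ⟩
        0ℤ + M * sum (+_ ∘ τ)            ≡⟨ ℤ.+-identityˡ (M * sum (+_ ∘ τ)) ⟩
        M * sum (+_ ∘ τ)                 ∎
        where open ≡-Reasoning
    p∣M : + p ∣ M
    p∣M = [ id , (λ p∣∑τ → contradiction p∣∑τ p∤∑τ) ]′ (∣-*-prime M (sum (+_ ∘ τ)) p∣M∑τ)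
    d+1≤2d : suc d ℕ.≤ double d
    d+1≤2d = s≤s (s≤s (s≤s (ℕ.m≤n⇒m≤1+n (n≤double[n] e))))
    σ : Fin (suc d) → Fin (double d)
    σ i = inject≤ i d+1≤2d
    p∣C : ∀ k → + p ∣ C k
    p∣C zero    = p∣M
    p∣C (suc k) = affineRelation-divisible (τ ∘ σ)
      (λ i j i≢j → distinct (σ i) (σ j) (i≢j ∘ Fin.inject≤-injective d+1≤2d d+1≤2d i j))
      (C ∘ suc)
      (λ i → ∣m+n∣m⇒∣n (subst (+ p ∣_) (sym (rel (σ i))) (divides 0ℤ refl)) (∣m⇒∣m*n _ p∣M))
      k

module Geometry where

  open import Data.Nat.Base as ℕ using (ℕ; zero; suc; z≤n; s≤s; _≤_; _*_)
  import Data.Nat.Properties as ℕ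
  open import Data.Fin.Base using (Fin; zero; suc; toℕ; cast)
  import Data.Fin.Properties as Fin
  open import Data.List.Base using (List; []; _∷_)
  open import Data.List.Membership.Propositional using (_∈_)
  open import Data.List.Relation.Unary.Any using (here)
  open import Data.Product.Base using (_×_; _,_; proj₁; proj₂)
  open import Data.Rational.Base as ℚ using (ℚ)
  open import Data.Rational.Solver using (module +-*-Solver)
  open import Function.Base using (_∘_)
  open import Function.Definitions using (Injective)
  open import Relation.Nullary using (¬_)
  open import Relation.Binary.PropositionalEquality
  open import Defs

  onCommonHyperplane-reindex : ∀ {d k m} {P : Fin m → Point d} {Q : Fin k → Point d} (f : Fin k → Fin m) →
                               (∀ i → Q i ≡ P (f i)) → OnCommonHyperplane P → OnCommonHyperplane Q
  onCommonHyperplane-reindex f Q≡P∘f (a , b , a≢0 , on) = a , b , a≢0 , λ i → subst (OnHyperplane a b) (sym (Q≡P∘f i)) (on (f i))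

  onCommonSphere-reindex : ∀ {d k m} {P : Fin m → Point d} {Q : Fin k → Point d} (f : Fin k → Fin m) →
                           (∀ i → Q i ≡ P (f i)) → OnCommonSphere P → OnCommonSphere Q
  onCommonSphere-reindex f Q≡P∘f (c , ρ , ρ>0 , on) = c , ρ , ρ>0 , λ i → subst (OnSphere c ρ) (sym (Q≡P∘f i)) (on (f i))

  sumℚ-expand-squares : ∀ m (X c : Fin m → ℚ) →
    sumℚ m (λ j → (X j ℚ.- c j) ℚ.* (X j ℚ.- c j)) ≡
    sumℚ m (λ j → X j ℚ.* X j) ℚ.+ sumℚ m (λ j → ℚ.- (c j ℚ.+ c j) ℚ.* X j) ℚ.+ sumℚ m (λ j → c j ℚ.* c j)
  sumℚ-expand-squares zero    X c = refl
  sumℚ-expand-squares (suc m) X c =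
    trans (cong (ℚ._+_ ((X zero ℚ.- c zero) ℚ.* (X zero ℚ.- c zero))) (sumℚ-expand-squares m (X ∘ suc) (c ∘ suc)))
          (expand (X zero) (c zero) _ _ _)
    where
    open +-*-Solver
    expand : ∀ x c A B C → (x ℚ.- c) ℚ.* (x ℚ.- c) ℚ.+ (A ℚ.+ B ℚ.+ C) ≡
                           (x ℚ.* x ℚ.+ A) ℚ.+ (ℚ.- (c ℚ.+ c) ℚ.* x ℚ.+ B) ℚ.+ (c ℚ.* c ℚ.+ C)
    expand = solve 5 (λ x c A B C → (x :- c) :* (x :- c) :+ (A :+ B :+ C) :=
                                     (x :* x :+ A) :+ ((:- (c :+ c)) :* x :+ B) :+ (c :* c :+ C)) refl

  GeneralPosition : ∀ {d} → List (Point d) → Set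
  GeneralPosition {d} A =
    ((P : Fin (suc d) → Point d) → Injective _≡_ _≡_ P → (∀ i → P i ∈ A) → ¬ OnCommonHyperplane P) ×
    ((P : Fin (2 * d) → Point d) → Injective _≡_ _≡_ P → (∀ i → P i ∈ A) → ¬ OnCommonSphere P)

  injective-into-[x]⇒≤1 : ∀ {m} {A : Set} {x : A} (P : Fin m → A) → Injective _≡_ _≡_ P → (∀ i → P i ∈ x ∷ []) → m ≤ 1
  injective-into-[x]⇒≤1 {zero}        P _ _ = z≤n
  injective-into-[x]⇒≤1 {suc zero}    P _ _ = s≤s z≤n
  injective-into-[x]⇒≤1 {suc (suc m)} P P-injective P∈ with P∈ zero | P∈ (suc zero)
  ... | here P₀≡x | here P₁≡x with P-injective (trans P₀≡x (sym P₁≡x))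
  ... | ()

  singleton-generalPosition : ∀ {d} (x : Point (suc d)) → GeneralPosition (x ∷ [])
  singleton-generalPosition {d} x =
    (λ P P-injective P∈ _ → ℕ.<⇒≱ (s≤s (s≤s z≤n)) (injective-into-[x]⇒≤1 P P-injective P∈)) ,
    (λ P P-injective P∈ _ → ℕ.<⇒≱ (ℕ.m≤m*n 2 (suc d)) (injective-into-[x]⇒≤1 P P-injective P∈))

  inGrid-mono : ∀ {d m n} {x : Point d} → m ≤ n → InGrid m x → InGrid n x
  inGrid-mono m≤n x∈[m]ᵈ j = proj₁ (x∈[m]ᵈ j) , ℕ.≤-trans (proj₂ (x∈[m]ᵈ j)) m≤n

  cast-injective : ∀ {m n} (eq : m ≡ n) {i j : Fin m} → cast eq i ≡ cast eq j → i ≡ j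
  cast-injective eq {i} {j} cᵢ≡cⱼ =
    Fin.toℕ-injective (trans (sym (Fin.toℕ-cast eq i)) (trans (cong toℕ cᵢ≡cⱼ) (Fin.toℕ-cast eq j)))


module MomentCurve {p} (p-prime : Prime p) where

  open import Data.Nat.Base as ℕ using (ℕ; zero; suc; z≤n; s≤s; z<s; _≤_; _<_; _%_)
  import Data.Nat.Properties as ℕ
  open import Data.Nat.DivMod using (m%n<n; m<n⇒m%n≡m)
  open import Data.Nat.Divisibility using (m%n≡0⇒n∣m)
  open import Data.Integer.Base as ℤ using (ℤ; +_; 0ℤ)
  import Data.Integer.Properties as ℤ
  open import Data.Integer.Divisibility.Signed using (_∣_; divides)
  open import Algebra.Properties.Semiring.Sum ℤ.+-*-semiring using (sum; sum-syntax)
  open import Data.Fin.Base using (Fin; zero; suc; toℕ; cast)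
  import Data.Fin.Properties as Fin
  open import Data.List.Base using (List; tabulate; length)
  open import Data.List.Properties using (length-tabulate)
  open import Data.List.Membership.Propositional using (_∈_)
  open import Data.List.Membership.Propositional.Properties using (∈-tabulate⁻)
  open import Data.List.Relation.Unary.Unique.Propositional using (Unique)
  import Data.List.Relation.Unary.Unique.Propositional.Properties as Unique
  open import Data.Product.Base using (_×_; _,_; proj₁; proj₂)
  open import Data.Empty using (⊥-elim)
  open import Data.Rational.Base as ℚ using (ℚ; 0ℚ; 1ℚ)
  import Data.Rational.Properties as ℚ
  open import Data.Rational.Solver using (module +-*-Solver)
  open import Data.Vec.Functional using (_∷_)
  open import Function.Base using (_∘_; id)
  open import Function.Definitions using (Injective)
  open import Relation.Nullary using (¬_)
  open import Relation.Binary.PropositionalEquality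
  open import Defs
  open Primes
  open Polynomial using (double; 2*n≡double[n])
  open Polynomial.Roots p-prime using (Distinct)
  open Rationals using (ι; ι-sum; ι-*; sumℚ-cong)
  open LinearRelations using (IntRelation; RatRelation; ratRelation-trivial)
  open Congruence p-prime
  open ModularRelations p-prime
  open Geometry

  momentPoint-zero : ∀ {d t} → t < p → momentPoint {suc d} t zero ≡ t
  momentPoint-zero {t = t} t<p = trans (cong (_% p) (ℕ.*-identityʳ t)) (m<n⇒m%n≡m t<p)

  momentPoint-inGrid : ∀ {d t} → 0 < t → t < p → InGrid p (momentPoint {d} t)
  momentPoint-inGrid {t = t} 0<t t<p j = 1≤x , ℕ.<⇒≤ (m%n<n _ p)
    where
    1≤x : 1 ≤ momentPoint t j
    1≤x with momentPoint t j in x≡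
    ... | zero  = ⊥-elim (∤-^ p-prime (suc (toℕ j)) (∤-< p-prime 0<t t<p) (m%n≡0⇒n∣m _ p x≡))
    ... | suc _ = s≤s z≤n

  -- a hyperplane a · x = b through the points is the relation (-b, a) among the columns of affineRow
  momentPoints-noHyperplane : ∀ {d} (τ : Fin (suc d) → ℕ) → Distinct (+_ ∘ τ) → ¬ OnCommonHyperplane (momentPoint {d} ∘ τ)
  momentPoints-noHyperplane {d} τ τ-distinct (a , b , (j , aⱼ≢0) , on) =
    aⱼ≢0 (ratRelation-trivial (prime⇒>1 p-prime) (affineRow ∘ τ) divisible {(ℚ.- b) ∷ a} rel (suc j))
    where
    open ≡-Reasoning
    rel : RatRelation (affineRow ∘ τ) ((ℚ.- b) ∷ a)
    rel i = begin
      ℚ.- b ℚ.* 1ℚ ℚ.+ sumℚ d (λ j → a j ℚ.* toℚ (momentPoint (τ i) j)) ≡⟨ cong (ℚ.- b ℚ.* 1ℚ ℚ.+_) (on i) ⟩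
      ℚ.- b ℚ.* 1ℚ ℚ.+ b                                            ≡⟨ cong (ℚ._+ b) (ℚ.*-identityʳ (ℚ.- b)) ⟩
      ℚ.- b ℚ.+ b                                                   ≡⟨ ℚ.+-inverseˡ b ⟩
      0ℚ                                                            ∎
    divisible : ∀ {C} → IntRelation (affineRow ∘ τ) C → ∀ k → + p ∣ C k
    divisible {C} C-rel = affineRelation-divisible τ τ-distinct C λ i → subst (+ p ∣_) (sym (C-rel i)) (divides 0ℤ refl)

  ι-sumSquares : ∀ {d} (x : Point d) → ι (∑[ j < d ] (+ x j ℤ.* + x j)) ≡ sumℚ d (λ j → toℚ (x j) ℚ.* toℚ (x j))
  ι-sumSquares {d} x = trans (ι-sum (λ j → + x j ℤ.* + x j)) (sumℚ-cong d (λ j → ι-* (+ x j) (+ x j)))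

  -- a sphere |x - c|² = ρ through the points is the relation (1, |c|² - ρ, -2c) among the columns of sphereRow
  momentPoints-noSphere : ∀ {e} (τ : Fin (double (suc (suc e))) → ℕ) → Distinct (+_ ∘ τ) → ¬ + p ∣ sum (+_ ∘ τ) →
                          ¬ OnCommonSphere (momentPoint {suc (suc e)} ∘ τ)
  momentPoints-noSphere {e} τ τ-distinct p∤∑τ (c , ρ , _ , on) =
    ℚ.1≢0 (ratRelation-trivial (prime⇒>1 p-prime) (sphereRow ∘ τ) (sphereRelation-divisible τ τ-distinct p∤∑τ) {v} rel zero)
    where
    d = suc (suc e)
    v : Fin (suc (suc d)) → ℚ
    v = 1ℚ ∷ (sumℚ d (λ j → c j ℚ.* c j) ℚ.- ρ) ∷ λ j → ℚ.- (c j ℚ.+ c j)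
    rel : RatRelation (sphereRow ∘ τ) v
    rel i = begin
      1ℚ ℚ.* ι (∑[ j < d ] (+ x j ℤ.* + x j)) ℚ.+ ((SC ℚ.- ρ) ℚ.* 1ℚ ℚ.+ SL)
                                              ≡⟨ cong (λ y → 1ℚ ℚ.* y ℚ.+ ((SC ℚ.- ρ) ℚ.* 1ℚ ℚ.+ SL)) (ι-sumSquares x) ⟩
      1ℚ ℚ.* SX ℚ.+ ((SC ℚ.- ρ) ℚ.* 1ℚ ℚ.+ SL) ≡⟨ regroup SX SL SC ρ ⟩
      SX ℚ.+ SL ℚ.+ SC ℚ.- ρ                  ≡⟨ cong (ℚ._- ρ) (trans (sym (sumℚ-expand-squares d (toℚ ∘ x) c)) (on i)) ⟩
      ρ ℚ.- ρ                                 ≡⟨ ℚ.+-inverseʳ ρ ⟩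
      0ℚ                                      ∎
      where
      open ≡-Reasoning
      open +-*-Solver
      x = momentPoint (τ i)
      SX = sumℚ d (λ j → toℚ (x j) ℚ.* toℚ (x j))
      SL = sumℚ d (λ j → ℚ.- (c j ℚ.+ c j) ℚ.* toℚ (x j))
      SC = sumℚ d (λ j → c j ℚ.* c j)
      regroup : ∀ SX SL SC ρ → 1ℚ ℚ.* SX ℚ.+ ((SC ℚ.- ρ) ℚ.* 1ℚ ℚ.+ SL) ≡ SX ℚ.+ SL ℚ.+ SC ℚ.- ρ
      regroup = solve 4 (λ SX SL SC ρ → con 1ℚ :* SX :+ ((SC :- ρ) :* con 1ℚ :+ SL) := SX :+ SL :+ SC :- ρ) refl

  momentCurve : ∀ {d} → ℕ → List (Point d)
  momentCurve T = tabulate {n = T} (λ i → momentPoint (suc (toℕ i)))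

  length-momentCurve : ∀ {d} T → length (momentCurve {d} T) ≡ T
  length-momentCurve T = length-tabulate _

  module _ {T : ℕ} (T<p : T < p) where

    momentCurve-unique : ∀ {d} → Unique (momentCurve {suc d} T)
    momentCurve-unique {d} = Unique.tabulate⁺ λ {i} {j} eq → Fin.toℕ-injective (ℕ.suc-injective
      (trans (sym (momentPoint-zero {d} (ℕ.<-≤-trans (s≤s (Fin.toℕ<n i)) T<p)))
        (trans (cong (λ x → x zero) eq) (momentPoint-zero {d} (ℕ.<-≤-trans (s≤s (Fin.toℕ<n j)) T<p)))))

    momentCurve-inGrid : ∀ {d} (x : Point d) → x ∈ momentCurve T → InGrid p x
    momentCurve-inGrid x x∈ with ∈-tabulate⁻ x∈
    ... | i , refl = momentPoint-inGrid z<s (ℕ.<-≤-trans (s≤s (Fin.toℕ<n i)) T<p)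

    record Parameters {d m} (P : Fin m → Point d) : Set where
      field
        τ           : Fin m → ℕ
        P≡          : ∀ i → P i ≡ momentPoint (τ i)
        τ-injective : ∀ {i j} → τ i ≡ τ j → i ≡ j
        τ∈[1,T]     : ∀ i → 1 ≤ τ i × τ i ≤ T

      τ-distinct : Distinct (+_ ∘ τ)
      τ-distinct = distinct τ τ-injective λ i → ℕ.≤-<-trans (proj₂ (τ∈[1,T] i)) T<p

    parameters : ∀ {d m} (P : Fin m → Point d) → Injective _≡_ _≡_ P → (∀ i → P i ∈ momentCurve T) →
                 Parameters P
    parameters P P-injective P∈ = record
      { τ           = τ
      ; P≡          = P≡
      ; τ-injective = λ {i} {j} τᵢ≡τⱼ → P-injective (trans (P≡ i) (trans (cong momentPoint τᵢ≡τⱼ) (sym (P≡ j))))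
      ; τ∈[1,T]     = λ i → s≤s z≤n , Fin.toℕ<n (σ i)
      }
      where
      σ : Fin _ → Fin T
      σ i = proj₁ (∈-tabulate⁻ (P∈ i))
      τ : Fin _ → ℕ
      τ i = suc (toℕ (σ i))
      P≡ : ∀ i → P i ≡ momentPoint (τ i)
      P≡ i = proj₂ (∈-tabulate⁻ (P∈ i))

    momentCurve-noHyperplane : ∀ {d} (P : Fin (suc d) → Point d) → Injective _≡_ _≡_ P →
                               (∀ i → P i ∈ momentCurve T) → ¬ OnCommonHyperplane P
    momentCurve-noHyperplane P P-injective P∈ onP =
      momentPoints-noHyperplane τ τ-distinct (onCommonHyperplane-reindex {P = P} {Q = momentPoint ∘ τ} id (sym ∘ P≡) onP)
      where open Parameters (parameters P P-injective P∈)

    momentCurve-noSphere : ∀ {e} → let d = suc (suc e) in double d ℕ.* T < p →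
                           (P : Fin (2 ℕ.* d) → Point d) → Injective _≡_ _≡_ P →
                           (∀ i → P i ∈ momentCurve T) → ¬ OnCommonSphere P
    momentCurve-noSphere {e} 2dT<p P P-injective P∈ onP =
      momentPoints-noSphere τ τ-distinct (∤sum τ τ∈[1,T] 2dT<p)
        (onCommonSphere-reindex {P = P} {Q = momentPoint ∘ τ} σ (sym ∘ P≡) onP)
      where
      2d≡double : 2 ℕ.* suc (suc e) ≡ double (suc (suc e))
      2d≡double = 2*n≡double[n] (suc (suc e))
      σ = cast (sym 2d≡double)
      open Parameters (parameters (P ∘ σ) (cast-injective (sym 2d≡double) ∘ P-injective) (P∈ ∘ σ))


module LargeSets where

  open import Data.Nat.Base as ℕ using (ℕ; zero; suc; s≤s; _+_; _*_; _≤_; _<_; _/_; _%_)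
  import Data.Nat.Properties as ℕ
  open import Data.Nat.DivMod using (m/n*n≤m; m≡m%n+[m/n]*n; m%n<n)
  open import Data.Nat.Tactic.RingSolver using (solve-∀)
  open import Data.Nat.Coprimality using (1-coprimeTo)
  import Data.Nat.Coprimality as Coprimality
  open import Data.Nat.Primality using (Prime)
  open import Data.Integer.Base as ℤ using (+_)
  import Data.Integer.Properties as ℤ
  open import Data.Rational.Base as ℚ using (ℚ; mkℚ; 0ℚ; 1ℚ)
  import Data.Rational.Properties as ℚ
  open import Data.List.Base using (List; []; _∷_; length)
  open import Data.List.Membership.Propositional using (_∈_)
  open import Data.List.Relation.Unary.Any using (here)
  open import Data.List.Relation.Unary.Unique.Propositional using (Unique)
  open import Data.List.Relation.Unary.AllPairs using ([]; _∷_)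
  import Data.List.Relation.Unary.All as All
  open import Data.Product.Base using (Σ; _×_; _,_)
  open import Data.Empty using (⊥-elim)
  open import Relation.Nullary using (Dec; yes; no)
  open import Relation.Binary.PropositionalEquality
  open import Defs using (Point; InGrid)
  open Rationals using (ι; ι≡mkℚ; ι-+-*; ι-mono-≤)
  open Bertrand using (prime-in-range)
  open Polynomial using (double; 2*n≡double[n])
  open Geometry

  y<k*[1+y/k] : ∀ y k .{{_ : ℕ.NonZero k}} → y < k * suc (y / k)
  y<k*[1+y/k] y k = begin-strict
    y                 ≡⟨ m≡m%n+[m/n]*n y k ⟩
    y % k + y / k * k <⟨ ℕ.+-monoˡ-< (y / k * k) (m%n<n y k) ⟩
    k + y / k * k     ≡⟨ ℕ.*-comm (suc (y / k)) k ⟩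
    k * suc (y / k)   ∎
    where open ℕ.≤-Reasoning

  n≤[1+1024d]*⌊y/2d⌋ : ∀ d {n y} .{{_ : ℕ.NonZero (2 * d)}} → suc (1024 * d) ≤ n → n < 128 * y →
                       n ≤ suc (1024 * d) * (y / (2 * d))
  n≤[1+1024d]*⌊y/2d⌋ d {n} {y} D≤n n<128y with y / (2 * d) | y<k*[1+y/k] y (2 * d)
  ... | zero   | y<2d = ⊥-elim (ℕ.<⇒≱ (ℕ.<-≤-trans n<128y (begin
    128 * y           ≤⟨ ℕ.*-monoʳ-≤ 128 (ℕ.<⇒≤ y<2d) ⟩
    128 * (2 * d * 1) ≡⟨ small d ⟩
    256 * d           ≤⟨ ℕ.*-monoˡ-≤ d (ℕ.m≤m+n 256 768) ⟩
    1024 * d          <⟨ ℕ.n<1+n (1024 * d) ⟩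
    suc (1024 * d)    ∎)) D≤n)
    where
    open ℕ.≤-Reasoning
    small : ∀ d → 128 * (2 * d * 1) ≡ 256 * d
    small = solve-∀
  ... | suc T | y<2d[2+T] = begin
    n                          ≤⟨ ℕ.<⇒≤ n<128y ⟩
    128 * y                    ≤⟨ ℕ.*-monoʳ-≤ 128 (ℕ.<⇒≤ y<2d[2+T]) ⟩
    128 * (2 * d * suc (suc T)) ≤⟨ ℕ.m≤m+n _ (suc T + 512 * d + 768 * d * T) ⟩
    128 * (2 * d * suc (suc T)) + (suc T + 512 * d + 768 * d * T) ≡⟨ expand d T ⟩
    suc (1024 * d) * suc T     ∎
    where
    open ℕ.≤-Reasoning
    expand : ∀ d T → 128 * (2 * d * suc (suc T)) + (suc T + 512 * d + 768 * d * T) ≡ suc (1024 * d) * suc T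
    expand = solve-∀

  module _ (d : ℕ) where

    -- the denominator 1 + 1024 d of the constant, as a rational in normal form
    D : ℚ
    D = mkℚ (+ suc (1024 * d)) 0 (Coprimality.sym (1-coprimeTo (suc (1024 * d))))

    c : ℚ
    c = ℚ.1/ D

    c>0 : 0ℚ ℚ.< c
    c>0 = ℚ.positive⁻¹ c

    c*n≤L : ∀ {n L} → n ≤ suc (1024 * d) * L → c ℚ.* ι (+ n) ℚ.≤ ι (+ L)
    c*n≤L {n} {L} n≤DL = begin
      c ℚ.* ι (+ n)                      ≤⟨ ℚ.*-monoˡ-≤-nonNeg c (ι-mono-≤ (ℤ.+≤+ n≤DL)) ⟩
      c ℚ.* ι (+ (suc (1024 * d) * L))   ≡⟨ cong (c ℚ.*_) (trans (ι-+-* (suc (1024 * d)) L) (cong (ℚ._* ι (+ L)) (ι≡mkℚ _))) ⟩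
      c ℚ.* (D ℚ.* ι (+ L))              ≡⟨ ℚ.*-assoc c D (ι (+ L)) ⟨
      c ℚ.* D ℚ.* ι (+ L)                ≡⟨ cong (ℚ._* ι (+ L)) (ℚ.*-inverseˡ D) ⟩
      1ℚ ℚ.* ι (+ L)                     ≡⟨ ℚ.*-identityˡ (ι (+ L)) ⟩
      ι (+ L)                            ∎
      where open ℚ.≤-Reasoning

  Witness : (d : ℕ) → ℚ → ℕ → Set
  Witness d c n = Σ (List (Point d)) λ A →
    Unique A × (∀ x → x ∈ A → InGrid n x) × (c ℚ.* ι (+ n) ℚ.≤ ι (+ length A)) × GeneralPosition A

  singleton-witness : ∀ {d n} → 1 ≤ n → n < suc (1024 * suc d) → Witness (suc d) (c (suc d)) n
  singleton-witness {d} {n} 1≤n n<D =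
    (λ _ → 1) ∷ [] , All.[] ∷ [] , (λ { x (here refl) j → ℕ.≤-refl , 1≤n }) ,
    c*n≤L (suc d) {n} {1} (ℕ.≤-trans (ℕ.<⇒≤ n<D) (ℕ.≤-reflexive (sym (ℕ.*-identityʳ _)))) ,
    singleton-generalPosition (λ _ → 1)

  momentCurve-witness : ∀ e {n p y} → let d = suc (suc e) in Prime p → y < p → p ≤ n →
                        suc (1024 * d) ≤ n → n < 128 * y → Witness d (c d) n
  momentCurve-witness e {n} {p} {y} p-prime y<p p≤n D≤n n<128y =
    momentCurve T , momentCurve-unique T<p , (λ x x∈ → inGrid-mono p≤n (momentCurve-inGrid T<p x x∈)) ,
    subst (λ L → c d ℚ.* ι (+ n) ℚ.≤ ι (+ L)) (sym (length-momentCurve T))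
      (c*n≤L d {n} {T} (n≤[1+1024d]*⌊y/2d⌋ d {n} {y} D≤n n<128y)) ,
    momentCurve-noHyperplane T<p , momentCurve-noSphere T<p 2dT<p
    where
    open MomentCurve p-prime
    d = suc (suc e)
    T = y / (2 * d)
    2dT≤y : 2 * d * T ≤ y
    2dT≤y = subst (_≤ y) (ℕ.*-comm T (2 * d)) (m/n*n≤m y (2 * d))
    2dT<p : double d * T < p
    2dT<p = subst (λ k → k * T < p) (2*n≡double[n] d) (ℕ.≤-<-trans 2dT≤y y<p)
    T<p : T < p
    T<p = ℕ.≤-<-trans (ℕ.m≤n*m T (2 * d)) (ℕ.≤-<-trans 2dT≤y y<p)

  witness : ∀ e n → 1 ≤ n → let d = suc (suc e) in Dec (n < suc (1024 * d)) → Witness d (c d) n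
  witness e n 1≤n (yes n<D) = singleton-witness 1≤n n<D
  witness e n 1≤n (no  n≮D) =
    let (p , y , p-prime , y<p , p≤n , n<128y) = prime-in-range n (ℕ.≤-trans (ℕ.m≤m*n 1024 (suc (suc e))) (ℕ.<⇒≤ D≤n))
    in momentCurve-witness e p-prime y<p p≤n D≤n n<128y
    where
    D≤n : suc (1024 * suc (suc e)) ≤ n
    D≤n = ℕ.≮⇒≥ n≮D


open import Defs
open import Data.Nat using (ℕ; suc; _≤_; _*_)
open import Data.Integer using (+_)
open import Data.Fin using (Fin)
open import Data.List using (List; length)
open import Data.List.Membership.Propositional using (_∈_)
open import Data.List.Relation.Unary.Unique.Propositional using (Unique)
open import Data.Product using (Σ; _×_)
open import Data.Rational as ℚ using (ℚ; 0ℚ; _/_)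
open import Function.Definitions using (Injective)
open import Relation.Binary.PropositionalEquality using (_≡_)
open import Relation.Nullary using (¬_)
open import Data.Nat using (zero; s≤s; _<?_)
open import Data.Product using (_,_)

theorem4p1 : (d : ℕ) → 2 ≤ d →
    Σ ℚ λ c → (0ℚ ℚ.< c) ×
      ((n : ℕ) → 1 ≤ n →
        Σ (List (Point d)) λ A →
          Unique A ×
          (∀ p → p ∈ A → InGrid n p) ×
          (c ℚ.* (+ n / 1) ℚ.≤ (+ length A / 1)) ×
          ((P : Fin (suc d) → Point d) → Injective _≡_ _≡_ P →
             (∀ i → P i ∈ A) → ¬ OnCommonHyperplane P) ×
          ((P : Fin (2 * d) → Point d) → Injective _≡_ _≡_ P →
             (∀ i → P i ∈ A) → ¬ OnCommonSphere P))
theorem4p1 (suc zero)    (s≤s ())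
theorem4p1 (suc (suc e)) _ =
  LargeSets.c d , LargeSets.c>0 d , λ n 1≤n → LargeSets.witness e n 1≤n (n <? suc (1024 * d))
  where d = suc (suc e)
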